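{- Let $q$ be a prime power and $k>1$ an integer. For a positive integer $K\le q^{k-1}+1$ let $N:=qK-(q-1)$, let $\mathcal{C}$ be an $[N,K,(q-1)(K-1)+1]_{q^k}$ MDS code and let $\mathcal{I}$ be an $[n,k,d]_q$ minimal code. Then the concatenation $\mathcal{I}\,\Box\,\mathcal{C}$ of $\mathcal{C}$ with $\mathcal{I}$ (with respect to any $\mathbb{F}_q$-linear injection $\pi:\mathbb{F}_{q^k}\to\mathbb{F}_q^n$ with image $\mathcal{I}$) is a $[(qK-q+1)n,Kk,\ge((q-1)(K-1)+1)d]_q$ minimal code. Thus there exists a strong blocking set in $\mathrm{PG}(Kk-1,q)$ of size $nqK-qn+n$, for any $K\le q^{k-1}+1$.
   Context: For $v\in\mathbb{F}_q^n$, $\sigma(v)=\{i:v_i\ne0\}$. A code is minimal if for every nonzero codeword $c$, every nonzero codeword $c'$ with $\sigma(c')\subseteq\sigma(c)$ is a scalar multiple of $c$. For an $\mathbb{F}_q$-linear injection $\pi:\mathbb{F}_{q^k}\to\mathbb{F}_q^n$ with $\pi(\mathbb{F}_{q^k})=\mathcal{I}$, the concatenation of an $\mathbb{F}_{q^k}$-linear code $\mathcal{C}\subseteq\mathbb{F}_{q^k}^N$ with $\mathcal{I}$ is $\{(\pi(c_1),\dots,\pi(c_N)):(c_1,\dots,c_N)\in\mathcal{C}\}\subseteq\mathbb{F}_q^{Nn}$. An MDS $[N,K,D]$ code has $D=N-K+1$. A strong blocking set in $\mathrm{PG}(m-1,q)$ is a point set $\mathcal{M}$ such that for every hyperplane $\mathcal{H}$,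 $\mathcal{M}\cap\mathcal{H}$ spans $\mathcal{H}$; it corresponds to the point set given by the columns of a generator matrix of a minimal code of dimension $m$. -}

module Defs where

open import Level using (0ℓ)
open import Data.Nat using (ℕ; zero; suc; _≤_) renaming (_+_ to _+ℕ_; _*_ to _*ℕ_; _^_ to _^ℕ_)
open import Data.Nat.Primality using (Prime)
open import Data.Fin using (Fin; remQuot)
import Data.Fin as Fin
open import Data.Product using (Σ; ∃; _×_; _,_; proj₁; proj₂)
open import Relation.Binary.PropositionalEquality using (_≡_)
open import Relation.Nullary using (¬_; Dec; yes; no)
open import Relation.Unary using (Pred)
open import Function using (_∘_)
open import Function.Bundles using (_↔_; _⇔_)

IsPrimePower : ℕ → Set
IsPrimePower q = Σ ℕ λ p → Σ ℕ λ e → Prime p × 1 ≤ e × q ≡ p ^ℕ e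

record Field : Set₁ where
  infixl 6 _+_
  infixl 7 _*_
  field
    Carrier : Set
    _≟_     : (x y : Carrier) → Dec (x ≡ y)
    0# 1#   : Carrier
    _+_ _*_ : Carrier → Carrier → Carrier
    -_      : Carrier → Carrier
    _⁻¹     : Carrier → Carrier
    +-assoc : ∀ x y z → (x + y) + z ≡ x + (y + z)
    +-comm  : ∀ x y → x + y ≡ y + x
    +-identityˡ : ∀ x → 0# + x ≡ x
    -‿inverseˡ  : ∀ x → (- x) + x ≡ 0#
    *-assoc : ∀ x y z → (x * y) * z ≡ x * (y * z)
    *-comm  : ∀ x y → x * y ≡ y * x
    *-identityˡ : ∀ x → 1# * x ≡ x
    distribˡ : ∀ x y z → x * (y + z) ≡ (x * y) + (x * z)
    0≢1     : ¬ (0# ≡ 1#)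
    ⁻¹-inverseˡ : ∀ x → ¬ (x ≡ 0#) → (x ⁻¹) * x ≡ 1#

HasOrder : Field → ℕ → Set
HasOrder F q = Field.Carrier F ↔ Fin q

record IsFieldHom (F E : Field) (ι : Field.Carrier F → Field.Carrier E) : Set where
  private
    module F = Field F
    module E = Field E
  field
    hom-+ : ∀ x y → ι (x F.+ y) ≡ ι x E.+ ι y
    hom-* : ∀ x y → ι (x F.* y) ≡ ι x E.* ι y
    hom-1 : ι F.1# ≡ E.1#

module _ (F : Field) where
  open Field F

  Vect : ℕ → Set
  Vect n = Fin n → Carrier

  zeroV : ∀ {n} → Vect n
  zeroV _ = 0#

  _⊕_ : ∀ {n} → Vect n → Vect n → Vect n
  (u ⊕ v) i = u i + v i

  _•_ : ∀ {n} → Carrier → Vect n → Vect n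
  (a • v) i = a * v i

  sumF : ∀ {m} → (Fin m → Carrier) → Carrier
  sumF {zero}  f = 0#
  sumF {suc m} f = f Fin.zero + sumF (f ∘ Fin.suc)

  linComb : ∀ {m n} → (Fin m → Carrier) → (Fin m → Vect n) → Vect n
  linComb u b j = sumF (λ i → u i * b i j)

  dot : ∀ {n} → Vect n → Vect n → Carrier
  dot u v = sumF (λ i → u i * v i)

  NonZero : ∀ {n} → Vect n → Set
  NonZero v = ∃ λ i → ¬ (v i ≡ 0#)

  wt : ∀ {n} → Vect n → ℕ
  wt {zero}  v = 0
  wt {suc n} v with v Fin.zero ≟ 0#
  ... | yes _ = wt (v ∘ Fin.suc)
  ... | no  _ = suc (wt (v ∘ Fin.suc))

  _⊆σ_ : ∀ {n} → Vect n → Vect n → Set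
  u ⊆σ v = ∀ i → ¬ (u i ≡ 0#) → ¬ (v i ≡ 0#)

  Code : ℕ → Set₁
  Code n = Pred (Vect n) 0ℓ

  record IsLinear {n} (C : Code n) : Set where
    field
      has-0 : C zeroV
      closed-+ : ∀ {u v} → C u → C v → C (u ⊕ v)
      closed-• : ∀ a {v} → C v → C (a • v)

  HasDimension : ∀ {n} → Code n → ℕ → Set
  HasDimension {n} C k = Σ (Fin k → Vect n) λ b →
      (∀ u → C (linComb u b))
    × (∀ c → C c → ∃ λ u → ∀ j → c j ≡ linComb u b j)
    × (∀ u → (∀ j → linComb u b j ≡ 0#) → ∀ i → u i ≡ 0#)

  MinDistAtLeast : ∀ {n} → Code n → ℕ → Set
  MinDistAtLeast C d = ∀ c → C c → NonZero c → d ≤ wt c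

  MinDist : ∀ {n} → Code n → ℕ → Set
  MinDist C d = MinDistAtLeast C d × (∃ λ c → C c × NonZero c × wt c ≡ d)

  record IsCode (n k d : ℕ) (C : Code n) : Set where
    field
      linear  : IsLinear C
      dim     : HasDimension C k
      minDist : MinDist C d

  record IsMDS (N K D : ℕ) (C : Code N) : Set where
    field
      code : IsCode N K D C
      singleton-bound-tight : D +ℕ K ≡ N +ℕ 1

  IsMinimal : ∀ {n} → Code n → Set
  IsMinimal C = ∀ c c' → C c → C c' → NonZero c → NonZero c' → c' ⊆σ c →
                ∃ λ λ' → ∀ j → c' j ≡ λ' * c j

  -- strong blocking set in PG(m-1, q), given as a family of M points
  -- (nonzero representative vectors): for every hyperplane H = ker h
  -- (h ≠ 0), the points lying in H span H.
  IsStrongBlockingSet : ∀ {M m} → (Fin M → Vect m) → Set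
  IsStrongBlockingSet {M} {m} p =
      (∀ j → NonZero (p j))
    × (∀ h → NonZero h → ∀ v → dot h v ≡ 0# →
         ∃ λ (u : Fin M → Carrier) →
             (∀ j → ¬ (dot h (p j) ≡ 0#) → u j ≡ 0#)
           × (∀ i → v i ≡ linComb u p i))

module _ (F E : Field) (ι : Field.Carrier F → Field.Carrier E) where
  private
    module F = Field F
    module E = Field E

  record IsLinearInjectionOnto {n} (π : E.Carrier → Vect F n) (I : Code F n) : Set where
    field
      π-+ : ∀ x y j → π (x E.+ y) j ≡ π x j F.+ π y j
      π-• : ∀ a x j → π (ι a E.* x) j ≡ a F.* π x j
      π-inj : ∀ x y → (∀ j → π x j ≡ π y j) → x ≡ y
      π-image : ∀ c → I c ⇔ (∃ λ x → ∀ j → π x j ≡ c j)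

  -- I □ C, a code of length N·n over F; position (a , b) ↦ π(c_a)_b
  concat : ∀ {N n} → (π : E.Carrier → Vect F n) → Code E N → Code F (N *ℕ n)
  concat {N} {n} π C w = ∃ λ c → C c ×
    (∀ i → w i ≡ π (c (proj₁ (remQuot {N} n i))) (proj₂ (remQuot {N} n i)))

-- A concatenated codeword is the expansion by π of its E-symbols c_a, so I □ C ≅ C ≅ E^K ≅ F^(Kk)
-- as F-spaces, and its weight is the sum of its block weights: at least d in each of the at least
-- D blocks where c is nonzero.
-- Minimality: let supp w′ ⊆ supp w. Minimality of I makes each block of w′ an F-multiple of the
-- same block of w, i.e. c′_a = λ_a c_a with λ_a ∈ F. There are N = q(K - 1) + 1 blocks but only q
-- possible factors, so one λ occurs in at least K blocks; then c′ - λ c ∈ C has K zeros and, C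
-- being MDS, vanishes, so w′ = λ w.
-- Blocking set: take for C the extended Reed–Solomon code of dimension K on q(K - 1) ≤ q^k points
-- of E; the points are the columns of a generator matrix of the minimal code I □ C. A vector of
-- a hyperplane ker h outside the span of the points it contains is separated from them by a
-- functional g, and then the codeword of g has support inside that of the codeword of h without
-- being proportional to it.

module Submission where

open import Defs
open import Level using (0ℓ)
open import Algebra.Bundles using (Monoid; Semiring; CommutativeRing)
open import Algebra.Consequences.Propositional
  using (comm∧idˡ⇒id; comm∧invˡ⇒inv; comm∧distrˡ⇒distrʳ)
open import Data.Nat as ℕ using (ℕ; zero; suc; z≤n; s≤s)
import Data.Nat.Properties as ℕ
open import Data.Fin as Fin using (Fin; zero; suc; toℕ; _↑ˡ_; _↑ʳ_; combine; remQuot)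
import Data.Fin.Properties as Fin
open import Data.Product using (Σ; ∃; _×_; _,_; proj₁; proj₂)
open import Data.Sum as Sum using (_⊎_; inj₁; inj₂)
open import Data.Vec.Functional using (Vector; _∷_; head; tail; init; last)
open import Function using (_∘_; case_of_; Injective; Inverse; Injection; Equivalence)
open import Function.Properties.Inverse using (↔⇒↣; ↔-sym)
open import Relation.Binary.PropositionalEquality
open import Relation.Nullary using (¬_; Dec; yes; no; ¬?; contradiction)
open import Relation.Nullary.Decidable using (decidable-stable)
open import Relation.Unary using (Pred; Decidable; _⊆_)
open import Data.Nat.Tactic.RingSolver using (solve-∀)

module SumBlocks {a ℓ} (M : Monoid a ℓ) where
  open Monoid M using (Carrier; _≈_; _∙_; ∙-congˡ; identityˡ; assoc)
    renaming (refl to ≈-refl; sym to ≈-sym; trans to ≈-trans)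
  open import Algebra.Properties.Monoid.Sum M using (sum; sum-syntax)

  sum-↑ : ∀ m {n} (f : Vector Carrier (m ℕ.+ n)) →
          sum f ≈ sum (f ∘ (_↑ˡ n)) ∙ sum (f ∘ (m ↑ʳ_))
  sum-↑ zero    f = ≈-sym (identityˡ _)
  sum-↑ (suc m) f = ≈-trans (∙-congˡ (sum-↑ m (f ∘ suc))) (≈-sym (assoc _ _ _))

  sum-combine : ∀ m {n} (f : Vector Carrier (m ℕ.* n)) →
                sum f ≈ ∑[ i < m ] ∑[ j < n ] f (combine i j)
  sum-combine zero    f = ≈-refl
  sum-combine (suc m) {n} f = ≈-trans (sum-↑ n f) (∙-congˡ (sum-combine m (f ∘ (n ↑ʳ_))))

module ℕ∑ where
  open import Algebra.Properties.CommutativeMonoid.Sum ℕ.+-0-commutativeMonoid public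
    using (sum; sum-syntax; ∑-comm; ∑-distrib-+; sum-cong-≗)
  open SumBlocks ℕ.+-0-monoid public

  ∑-one : ∀ n → ∑[ i < n ] 1 ≡ n
  ∑-one zero    = refl
  ∑-one (suc n) = cong suc (∑-one n)

  ∑-bounded : ∀ {n} (f : Fin n → ℕ) c → (∀ i → f i ℕ.≤ c) → sum f ℕ.≤ n ℕ.* c
  ∑-bounded {zero}  f c h = z≤n
  ∑-bounded {suc n} f c h = ℕ.+-mono-≤ (h zero) (∑-bounded (f ∘ suc) c (h ∘ suc))

open ℕ∑ using (sum-syntax)

𝟙 : ∀ {a} {A : Set a} → Dec A → ℕ
𝟙 (yes _) = 1
𝟙 (no _)  = 0

count : ∀ {n p} {P : Pred (Fin n) p} → Decidable P → ℕ
count {n} P? = ∑[ i < n ] 𝟙 (P? i)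

𝟙≤1 : ∀ {a} {A : Set a} (A? : Dec A) → 𝟙 A? ℕ.≤ 1
𝟙≤1 (yes _) = ℕ.≤-refl
𝟙≤1 (no _)  = z≤n

𝟙-mono : ∀ {a b} {A : Set a} {B : Set b} (A? : Dec A) (B? : Dec B) → (A → B) → 𝟙 A? ℕ.≤ 𝟙 B?
𝟙-mono (yes a) (yes _) A→B = ℕ.≤-refl
𝟙-mono (yes a) (no ¬b) A→B = contradiction (A→B a) ¬b
𝟙-mono (no _)  B?      A→B = z≤n

𝟙+𝟙¬≡1 : ∀ {a} {A : Set a} (A? : Dec A) → 𝟙 A? ℕ.+ 𝟙 (¬? A?) ≡ 1
𝟙+𝟙¬≡1 (yes _) = refl
𝟙+𝟙¬≡1 (no _)  = refl

𝟙-no : ∀ {a} {A : Set a} (A? : Dec A) → ¬ A → 𝟙 A? ≡ 0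
𝟙-no (yes a) ¬a = contradiction a ¬a
𝟙-no (no _)  ¬a = refl

o≤m∧m+n≡o+p⇒n≤p : ∀ {m n o p} → o ℕ.≤ m → m ℕ.+ n ≡ o ℕ.+ p → n ℕ.≤ p
o≤m∧m+n≡o+p⇒n≤p {m} {n} {o} {p} o≤m eq =
  ℕ.+-cancelˡ-≤ m n p (subst (ℕ._≤ m ℕ.+ p) (sym eq) (ℕ.+-monoˡ-≤ p o≤m))

count-mono : ∀ {n p q} {P : Pred (Fin n) p} {Q : Pred (Fin n) q} (P? : Decidable P) (Q? : Decidable Q) →
             P ⊆ Q → count P? ℕ.≤ count Q?
count-mono {zero}  P? Q? P⊆Q = z≤n
count-mono {suc n} P? Q? P⊆Q =
  ℕ.+-mono-≤ (𝟙-mono (P? zero) (Q? zero) P⊆Q) (count-mono (P? ∘ suc) (Q? ∘ suc) P⊆Q)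

count-cong : ∀ {n p q} {P : Pred (Fin n) p} {Q : Pred (Fin n) q} (P? : Decidable P) (Q? : Decidable Q) →
             P ⊆ Q → Q ⊆ P → count P? ≡ count Q?
count-cong P? Q? P⊆Q Q⊆P = ℕ.≤-antisym (count-mono P? Q? P⊆Q) (count-mono Q? P? Q⊆P)

count-all : ∀ {n p} {P : Pred (Fin n) p} (P? : Decidable P) → (∀ i → P i) → count P? ≡ n
count-all {zero}  P? all = refl
count-all {suc n} P? all with P? zero
... | yes _  = cong suc (count-all (P? ∘ suc) (all ∘ suc))
... | no ¬p0 = contradiction (all zero) ¬p0

count-none : ∀ {n p} {P : Pred (Fin n) p} (P? : Decidable P) → (∀ i → ¬ P i) → count P? ≡ 0
count-none {zero}  P? none = refl
count-none {suc n} P? none with P? zero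
... | yes p0 = contradiction p0 (none zero)
... | no _   = count-none (P? ∘ suc) (none ∘ suc)

count-complement : ∀ {n p} {P : Pred (Fin n) p} (P? : Decidable P) →
                   count P? ℕ.+ count (¬? ∘ P?) ≡ n
count-complement {n} P? = begin
  count P? ℕ.+ count (¬? ∘ P?)              ≡⟨ ℕ∑.∑-distrib-+ (𝟙 ∘ P?) (𝟙 ∘ ¬? ∘ P?) ⟨
  ∑[ i < n ] (𝟙 (P? i) ℕ.+ 𝟙 (¬? (P? i)))   ≡⟨ ℕ∑.sum-cong-≗ (𝟙+𝟙¬≡1 ∘ P?) ⟩
  ∑[ i < n ] 1                              ≡⟨ ℕ∑.∑-one n ⟩
  n                                         ∎
  where open ≡-Reasoning

count-combine : ∀ m {n p} {P : Pred (Fin (m ℕ.* n)) p} (P? : Decidable P) →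
                count P? ≡ ∑[ i < m ] count (λ j → P? (combine i j))
count-combine m P? = ℕ∑.sum-combine m (𝟙 ∘ P?)

count-weighted : ∀ {n p} {P : Pred (Fin n) p} (P? : Decidable P) (f : Fin n → ℕ) d →
                 (∀ i → P i → d ℕ.≤ f i) → count P? ℕ.* d ℕ.≤ ∑[ i < n ] f i
count-weighted {zero}  P? f d h = z≤n
count-weighted {suc n} P? f d h = begin
  (𝟙 (P? zero) ℕ.+ count (P? ∘ suc)) ℕ.* d        ≡⟨ ℕ.*-distribʳ-+ d (𝟙 (P? zero)) _ ⟩
  𝟙 (P? zero) ℕ.* d ℕ.+ count (P? ∘ suc) ℕ.* d    ≤⟨ ℕ.+-mono-≤ (first (P? zero) (h zero))
                                                       (count-weighted (P? ∘ suc) (f ∘ suc) d (h ∘ suc)) ⟩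
  f zero ℕ.+ ∑[ i < n ] f (suc i)                ∎
  where
  open ℕ.≤-Reasoning
  first : ∀ {a} {A : Set a} (A? : Dec A) → (A → d ℕ.≤ f zero) → 𝟙 A? ℕ.* d ℕ.≤ f zero
  first (yes a) d≤ = subst (ℕ._≤ f zero) (sym (ℕ.+-identityʳ d)) (d≤ a)
  first (no _)  _  = z≤n

count-enumerate : ∀ {n p} {P : Pred (Fin n) p} (P? : Decidable P) {m} → m ℕ.≤ count P? →
                  Σ (Fin m → Fin n) λ r → Injective _≡_ _≡_ r × (∀ i → P (r i))
count-enumerate P? {zero} _ = (λ ()) , (λ {i} → case i of λ ()) , λ ()
count-enumerate {suc n} P? {suc m} m<c with P? zero
... | no _ =
  let r , r-inj , Pr = count-enumerate (P? ∘ suc) m<c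
  in suc ∘ r , r-inj ∘ Fin.suc-injective , Pr
... | yes p0 =
  let r , r-inj , Pr = count-enumerate (P? ∘ suc) (ℕ.s≤s⁻¹ m<c)
  in Fin.lift 1 r , Fin.lift-injective r r-inj 1 , λ { zero → p0 ; (suc i) → Pr i }

count-singleton : ∀ {q} (x : Fin q) → count (x Fin.≟_) ≡ 1
count-singleton {suc q} zero    = cong suc (count-none {q} (λ v → zero Fin.≟ suc v) λ _ ())
count-singleton {suc q} (suc x) = trans (count-cong (λ v → suc x Fin.≟ suc v) (x Fin.≟_) Fin.suc-injective (cong suc))
                        (count-singleton x)

∑-fibres : ∀ {N q} (g : Fin N → Fin q) → ∑[ v < q ] count (λ a → g a Fin.≟ v) ≡ N
∑-fibres {N} {q} g = begin
  ∑[ v < q ] ∑[ a < N ] 𝟙 (g a Fin.≟ v)   ≡⟨ ℕ∑.∑-comm (λ a v → 𝟙 (g a Fin.≟ v)) ⟨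
  ∑[ a < N ] count (g a Fin.≟_)           ≡⟨ ℕ∑.sum-cong-≗ (count-singleton ∘ g) ⟩
  ∑[ a < N ] 1                            ≡⟨ ℕ∑.∑-one N ⟩
  N                                       ∎
  where open ≡-Reasoning

largeFibre : ∀ {N q} (g : Fin N → Fin q) K → q ℕ.* K ℕ.< N →
             ∃ λ v → K ℕ.< count (λ a → g a Fin.≟ v)
largeFibre {N} {q} g K qK<N with Fin.any? (λ v → K ℕ.<? count (λ a → g a Fin.≟ v))
... | yes large = large
... | no ¬large = contradiction N≤qK (ℕ.<⇒≱ qK<N)
  where
  N≤qK : N ℕ.≤ q ℕ.* K
  N≤qK = subst (ℕ._≤ q ℕ.* K) (∑-fibres g)
               (ℕ∑.∑-bounded _ K (λ v → ℕ.≮⇒≥ (λ K<c → ¬large (v , K<c))))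

module FieldProperties (F : Field) where
  open Field F public using (_≟_; _⁻¹; ⁻¹-inverseˡ; 0≢1)
  commutativeRing : CommutativeRing 0ℓ 0ℓ
  commutativeRing = record
    { isCommutativeRing = record
      { isRing = record
        { +-isAbelianGroup = record
          { isGroup = record
            { isMonoid = record
              { isSemigroup = record
                { isMagma = record { isEquivalence = isEquivalence ; ∙-cong = cong₂ F._+_ }
                ; assoc = F.+-assoc }
              ; identity = comm∧idˡ⇒id F.+-comm F.+-identityˡ }
            ; inverse = comm∧invˡ⇒inv F.+-comm F.-‿inverseˡ
            ; ⁻¹-cong = cong F.-_ }
          ; comm = F.+-comm }
        ; *-cong = cong₂ F._*_
        ; *-assoc = F.*-assoc
        ; *-identity = comm∧idˡ⇒id F.*-comm F.*-identityˡ
        ; distrib = F.distribˡ , comm∧distrˡ⇒distrʳ F.*-comm F.distribˡ }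
      ; *-comm = F.*-comm } }
    where module F = Field F

  open CommutativeRing commutativeRing public
    hiding (refl; sym; trans; reflexive; isEquivalence; zero)
  open import Algebra.Properties.Ring ring public using (-‿distribˡ-*; -‿distribʳ-*; -1*x≈-x; x+x≈x⇒x≈0)
  open import Algebra.Properties.CommutativeSemigroup *-commutativeSemigroup public
    using () renaming (x∙yz≈y∙xz to x*[y*z]≡y*[x*z])
  open import Algebra.Properties.CommutativeSemigroup +-commutativeSemigroup public
    using () renaming (x∙yz≈y∙xz to x+[y+z]≡y+[x+z])
  open import Algebra.Properties.Group +-group public using (x∙y⁻¹≈ε⇒x≈y; x≈y⇒x∙y⁻¹≈ε; inverseˡ-unique)
  open import Algebra.Properties.Semiring.Sum semiring public
    using (sum; ∑-distrib-+; *-distribˡ-sum; sum-replicate-zero)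

  1≢0 : 1# ≢ 0#
  1≢0 = 0≢1 ∘ sym

  x*y≡0⇒x≡0⊎y≡0 : ∀ x y → x * y ≡ 0# → x ≡ 0# ⊎ y ≡ 0#
  x*y≡0⇒x≡0⊎y≡0 x y xy≡0 with x ≟ 0#
  ... | yes x≡0 = inj₁ x≡0
  ... | no  x≢0 = inj₂ (begin
    y                ≡⟨ *-identityˡ y ⟨
    1# * y           ≡⟨ cong (_* y) (⁻¹-inverseˡ x x≢0) ⟨
    (x ⁻¹ * x) * y   ≡⟨ *-assoc _ x y ⟩
    x ⁻¹ * (x * y)   ≡⟨ cong (x ⁻¹ *_) xy≡0 ⟩
    x ⁻¹ * 0#        ≡⟨ zeroʳ _ ⟩
    0#               ∎)
    where open ≡-Reasoning

  sumF≡sum : ∀ {m} (f : Fin m → Carrier) → sumF F f ≡ sum f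
  sumF≡sum {zero}  f = refl
  sumF≡sum {suc m} f = cong (f zero +_) (sumF≡sum (f ∘ suc))

  sumF-cong : ∀ {m} {f g : Fin m → Carrier} → f ≗ g → sumF F f ≡ sumF F g
  sumF-cong {zero}  f≗g = refl
  sumF-cong {suc m} f≗g = cong₂ _+_ (f≗g zero) (sumF-cong (f≗g ∘ suc))

  sumF-+ : ∀ {m} (f g : Fin m → Carrier) → sumF F (λ i → f i + g i) ≡ sumF F f + sumF F g
  sumF-+ f g = begin
    sumF F (λ i → f i + g i)  ≡⟨ sumF≡sum (λ i → f i + g i) ⟩
    sum (λ i → f i + g i)     ≡⟨ ∑-distrib-+ f g ⟩
    sum f + sum g             ≡⟨ cong₂ _+_ (sumF≡sum f) (sumF≡sum g) ⟨
    sumF F f + sumF F g       ∎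
    where open ≡-Reasoning

  *-distribˡ-sumF : ∀ {m} a (f : Fin m → Carrier) → a * sumF F f ≡ sumF F (λ i → a * f i)
  *-distribˡ-sumF a f = begin
    a * sumF F f              ≡⟨ cong (a *_) (sumF≡sum f) ⟩
    a * sum f                 ≡⟨ *-distribˡ-sum a f ⟩
    sum (λ i → a * f i)       ≡⟨ sumF≡sum (λ i → a * f i) ⟨
    sumF F (λ i → a * f i)    ∎
    where open ≡-Reasoning

  *-distribʳ-sumF : ∀ {m} a (f : Fin m → Carrier) → sumF F f * a ≡ sumF F (λ i → f i * a)
  *-distribʳ-sumF a f =
    trans (*-comm _ a) (trans (*-distribˡ-sumF a f) (sumF-cong (λ i → *-comm a (f i))))

  sumF-zero : ∀ {m} (f : Fin m → Carrier) → (∀ i → f i ≡ 0#) → sumF F f ≡ 0#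
  sumF-zero {m} f f≡0 = trans (sumF-cong f≡0) (trans (sumF≡sum {m} _) (sum-replicate-zero m))

  sumF-combine : ∀ m {n} (f : Fin (m ℕ.* n) → Carrier) →
                 sumF F f ≡ sumF F (λ (i : Fin m) → sumF F (λ (j : Fin n) → f (combine i j)))
  sumF-combine m {n} f = begin
    sumF F f                           ≡⟨ sumF≡sum f ⟩
    sum f                              ≡⟨ SumBlocks.sum-combine +-monoid m f ⟩
    sum (λ i → sum (row i))            ≡⟨ sumF≡sum (λ i → sum (row i)) ⟨
    sumF F (λ i → sum (row i))         ≡⟨ sumF-cong (λ i → sumF≡sum (row i)) ⟨
    sumF F (λ i → sumF F (row i))      ∎
    where
    open ≡-Reasoning
    row : Fin m → Fin n → Carrier
    row i j = f (combine i j)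

  module _ {m n} (b : Fin m → Vect F n) where

    linComb-cong : ∀ {u u′} → u ≗ u′ → ∀ j → linComb F u b j ≡ linComb F u′ b j
    linComb-cong u≗u′ j = sumF-cong (λ i → cong (_* b i j) (u≗u′ i))

    linComb-+ : ∀ u u′ j → linComb F (λ i → u i + u′ i) b j ≡ linComb F u b j + linComb F u′ b j
    linComb-+ u u′ j = trans (sumF-cong (λ i → distribʳ (b i j) (u i) (u′ i)))
                             (sumF-+ (λ i → u i * b i j) (λ i → u′ i * b i j))

    linComb-• : ∀ a u j → linComb F (λ i → a * u i) b j ≡ a * linComb F u b j
    linComb-• a u j = trans (sumF-cong (λ i → *-assoc a (u i) (b i j)))
                             (sym (*-distribˡ-sumF a (λ i → u i * b i j)))

    linComb-zero : ∀ j → linComb F (λ _ → 0#) b j ≡ 0#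
    linComb-zero j = sumF-zero (λ i → 0# * b i j) (λ i → zeroˡ (b i j))

  module _ {n} (g : Vect F n) where

    dot-congʳ : ∀ {v w} → v ≗ w → dot F g v ≡ dot F g w
    dot-congʳ v≗w = sumF-cong (λ i → cong (g i *_) (v≗w i))

    dot-+ʳ : ∀ v w → dot F g (λ i → v i + w i) ≡ dot F g v + dot F g w
    dot-+ʳ v w = trans (sumF-cong (λ i → distribˡ (g i) (v i) (w i))) (sumF-+ (λ i → g i * v i) (λ i → g i * w i))

    dot-•ʳ : ∀ a v → dot F g (λ i → a * v i) ≡ a * dot F g v
    dot-•ʳ a v = trans (sumF-cong (λ i → x*[y*z]≡y*[x*z] (g i) a (v i))) (sym (*-distribˡ-sumF a (λ i → g i * v i)))

  dot-+ˡ : ∀ {n} (g h v : Vect F n) → dot F (λ i → g i + h i) v ≡ dot F g v + dot F h v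
  dot-+ˡ g h v = trans (sumF-cong (λ i → distribʳ (v i) (g i) (h i))) (sumF-+ (λ i → g i * v i) (λ i → h i * v i))

  dot-•ˡ : ∀ {n} a (g v : Vect F n) → dot F (λ i → a * g i) v ≡ a * dot F g v
  dot-•ˡ a g v = trans (sumF-cong (λ i → *-assoc a (g i) (v i))) (sym (*-distribˡ-sumF a (λ i → g i * v i)))

  single : ∀ {n} → Fin n → Carrier → Vect F n
  single zero    a zero    = a
  single zero    a (suc _) = 0#
  single (suc i) a zero    = 0#
  single (suc i) a (suc j) = single i a j

  dot-single : ∀ {n} (i : Fin n) a v → dot F (single i a) v ≡ a * v i
  dot-single zero a v = begin
    a * v zero + sumF F (λ j → 0# * v (suc j))   ≡⟨ cong (a * v zero +_) (sumF-zero _ (λ j → zeroˡ (v (suc j)))) ⟩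
    a * v zero + 0#                             ≡⟨ +-identityʳ _ ⟩
    a * v zero                                  ∎
    where open ≡-Reasoning
  dot-single (suc i) a v = trans (cong₂ _+_ (zeroˡ (v zero)) (dot-single i a (v ∘ suc))) (+-identityˡ _)

  nonZero? : ∀ {n} → Decidable (NonZero F {n})
  nonZero? v = Fin.any? (λ i → ¬? (v i ≟ 0#))

  ¬NonZero⇒≡0 : ∀ {n} {v : Vect F n} → ¬ NonZero F v → ∀ i → v i ≡ 0#
  ¬NonZero⇒≡0 {v = v} v≡0 i with v i ≟ 0#
  ... | yes vi≡0 = vi≡0
  ... | no  vi≢0 = contradiction (i , vi≢0) v≡0

  nonZero⇒dual : ∀ {n} {v : Vect F n} → NonZero F v → ∃ λ g → dot F g v ≡ 1#
  nonZero⇒dual {v = v} (i , vi≢0) = single i (v i ⁻¹) , trans (dot-single i _ v) (⁻¹-inverseˡ _ vi≢0)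

  zeros : ∀ {n} → Vect F n → ℕ
  zeros v = count (λ i → v i ≟ 0#)

  wt≡count : ∀ {n} (v : Vect F n) → wt F v ≡ count (λ i → ¬? (v i ≟ 0#))
  wt≡count {zero}  v = refl
  wt≡count {suc n} v with v zero ≟ 0#
  ... | yes _ = wt≡count (v ∘ suc)
  ... | no  _ = cong suc (wt≡count (v ∘ suc))

  zeros+wt≡n : ∀ {n} (v : Vect F n) → zeros v ℕ.+ wt F v ≡ n
  zeros+wt≡n v = trans (cong (zeros v ℕ.+_) (wt≡count v)) (count-complement (λ i → v i ≟ 0#))

  zeros-cong : ∀ {n} {v w : Vect F n} → v ≗ w → zeros v ≡ zeros w
  zeros-cong {v = v} {w} v≗w =
    count-cong (λ i → v i ≟ 0#) (λ i → w i ≟ 0#) (λ {i} → trans (sym (v≗w i))) (λ {i} → trans (v≗w i))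

  wt-cong : ∀ {n} {v w : Vect F n} → v ≗ w → wt F v ≡ wt F w
  wt-cong {n} {v} {w} v≗w = ℕ.+-cancelˡ-≡ (zeros v) _ _ (begin
    zeros v ℕ.+ wt F v   ≡⟨ zeros+wt≡n v ⟩
    n                    ≡⟨ zeros+wt≡n w ⟨
    zeros w ℕ.+ wt F w   ≡⟨ cong (ℕ._+ wt F w) (zeros-cong v≗w) ⟨
    zeros v ℕ.+ wt F w   ∎)
    where open ≡-Reasoning

  MDS⇒zeros≤K′ : ∀ {N K′ D} {C : Code F N} → IsMDS F N (suc K′) D C →
                 ∀ c → C c → NonZero F c → zeros c ℕ.≤ K′
  MDS⇒zeros≤K′ {N} {K′} {D} mds c c∈C c≢0 = o≤m∧m+n≡o+p⇒n≤p D≤wt (begin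
    wt F c ℕ.+ zeros c   ≡⟨ ℕ.+-comm (wt F c) (zeros c) ⟩
    zeros c ℕ.+ wt F c   ≡⟨ zeros+wt≡n c ⟩
    N                    ≡⟨ ℕ.suc-injective (begin
      suc N                 ≡⟨ ℕ.+-comm 1 N ⟩
      N ℕ.+ 1               ≡⟨ IsMDS.singleton-bound-tight mds ⟨
      D ℕ.+ suc K′          ≡⟨ ℕ.+-suc D K′ ⟩
      suc (D ℕ.+ K′)        ∎) ⟩
    D ℕ.+ K′             ∎)
    where
    open ≡-Reasoning
    D≤wt : D ℕ.≤ wt F c
    D≤wt = proj₁ (IsCode.minDist (IsMDS.code mds)) c c∈C c≢0

module Duality (F : Field) where
  open FieldProperties F

  _∈span_ : ∀ {m L} → Vect F m → (Fin L → Vect F m) → Set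
  v ∈span P = ∃ λ u → ∀ i → v i ≡ linComb F u P i

  Separates : ∀ {m L} → Vect F m → (Fin L → Vect F m) → Vect F m → Set
  Separates g P v = (∀ j → dot F g (P j) ≡ 0#) × dot F g v ≡ 1#

  ∈span-suc : ∀ {m L} {P : Fin (suc L) → Vect F m} {v} → v ∈span (P ∘ suc) → v ∈span P
  ∈span-suc {P = P} (u , v≡Σ) = (λ { zero → 0# ; (suc j) → u j }) , λ i →
    trans (v≡Σ i) (sym (trans (cong (_+ linComb F u (P ∘ suc) i) (zeroˡ (P zero i))) (+-identityˡ _)))

  module Pivot {m L} (P : Fin (suc L) → Vect F m) (v g : Vect F m)
               (g⊥P : ∀ j → dot F g (P (suc j)) ≡ 0#) (g·v≡1 : dot F g v ≡ 1#)
               (s : Carrier) (s·t≡1 : s * dot F g (P zero) ≡ 1#) where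

    sP₀ v′ : Vect F m
    sP₀ i = s * P zero i
    v′ i = v i - sP₀ i

    v≡v′+sP₀ : ∀ i → v i ≡ v′ i + sP₀ i
    v≡v′+sP₀ i = sym (trans (+-assoc _ _ _) (trans (cong (v i +_) (-‿inverseˡ _)) (+-identityʳ _)))

    span-lift : v′ ∈span (P ∘ suc) → v ∈span P
    span-lift (u , v′≡Σ) = (λ { zero → s ; (suc j) → u j }) , λ i →
      trans (v≡v′+sP₀ i) (trans (cong (_+ sP₀ i) (v′≡Σ i)) (+-comm _ _))

    separates-lift : ∀ {g′} → Separates g′ (P ∘ suc) v′ → ∃ λ g″ → Separates g″ P v
    separates-lift {g′} (g′⊥P , g′·v′≡1) = g″ , g″⊥P , g″·v≡1
      where
      a c : Carrier
      a = dot F g′ (P zero)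
      c = - (a * s)
      g″ : Vect F m
      g″ i = g′ i + c * g i
      g″·_ : ∀ w → dot F g″ w ≡ dot F g′ w + c * dot F g w
      g″· w = trans (dot-+ˡ g′ (λ i → c * g i) w) (cong (dot F g′ w +_) (dot-•ˡ c g w))
      g″⊥P : ∀ j → dot F g″ (P j) ≡ 0#
      g″⊥P zero = begin
        dot F g″ (P zero)                    ≡⟨ g″· P zero ⟩
        a + c * dot F g (P zero)             ≡⟨ cong (a +_) (-‿distribˡ-* (a * s) _) ⟨
        a - (a * s) * dot F g (P zero)       ≡⟨ cong (λ x → a - x) (trans (*-assoc a s _) (cong (a *_) s·t≡1)) ⟩
        a - a * 1#                           ≡⟨ cong (λ x → a - x) (*-identityʳ a) ⟩
        a - a                                ≡⟨ -‿inverseʳ a ⟩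
        0#                                   ∎
        where open ≡-Reasoning
      g″⊥P (suc j) = trans (g″· P (suc j))
        (trans (cong₂ (λ x y → x + c * y) (g′⊥P j) (g⊥P j)) (trans (+-identityˡ _) (zeroʳ c)))
      g″·v≡1 : dot F g″ v ≡ 1#
      g″·v≡1 = begin
        dot F g″ v                               ≡⟨ g″· v ⟩
        dot F g′ v + c * dot F g v               ≡⟨ cong₂ (λ x y → x + c * y) (dot-congʳ g′ v≡v′+sP₀) g·v≡1 ⟩
        dot F g′ (λ i → v′ i + sP₀ i) + c * 1#   ≡⟨ cong₂ _+_ (dot-+ʳ g′ v′ sP₀) (*-identityʳ c) ⟩
        (dot F g′ v′ + dot F g′ sP₀) + c         ≡⟨ cong₂ (λ x y → (x + y) + c) g′·v′≡1 g′·sP₀≡a*s ⟩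
        (1# + a * s) + c                         ≡⟨ +-assoc 1# (a * s) c ⟩
        1# + (a * s - a * s)                     ≡⟨ cong (1# +_) (-‿inverseʳ (a * s)) ⟩
        1# + 0#                                  ≡⟨ +-identityʳ 1# ⟩
        1#                                       ∎
        where
        open ≡-Reasoning
        g′·sP₀≡a*s : dot F g′ sP₀ ≡ a * s
        g′·sP₀≡a*s = trans (dot-•ʳ g′ s (P zero)) (*-comm s a)

  span⊎separates : ∀ {m L} (P : Fin L → Vect F m) (v : Vect F m) →
                   v ∈span P ⊎ ∃ λ g → Separates g P v
  span⊎separates {L = zero} P v with nonZero? v
  ... | no  v≡0 = inj₁ ((λ ()) , ¬NonZero⇒≡0 v≡0)
  ... | yes v≢0 = let g , g·v≡1 = nonZero⇒dual v≢0 in inj₂ (g , (λ ()) , g·v≡1)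
  span⊎separates {L = suc L} P v with span⊎separates (P ∘ suc) v
  ... | inj₁ v∈span = inj₁ (∈span-suc {P = P} v∈span)
  ... | inj₂ (g , g⊥P , g·v≡1) with dot F g (P zero) ≟ 0#
  ...   | yes g⊥P₀ = inj₂ (g , (λ { zero → g⊥P₀ ; (suc j) → g⊥P j }) , g·v≡1)
  ...   | no  t≢0  = Sum.map span-lift (separates-lift ∘ proj₂) (span⊎separates (P ∘ suc) v′)
    where open Pivot P v g g⊥P g·v≡1 (dot F g (P zero) ⁻¹) (⁻¹-inverseˡ _ t≢0)

module Independence (F : Field) {m M} {B : Fin m → Vect F M}
  (indep : ∀ u → (∀ j → linComb F u B j ≡ Field.0# F) → ∀ i → u i ≡ Field.0# F) where
  open FieldProperties F

  nonZero-linComb : ∀ {u} → NonZero F u → NonZero F (linComb F u B)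
  nonZero-linComb {u} (i , uᵢ≢0) with nonZero? (linComb F u B)
  ... | yes nz = nz
  ... | no  z  = contradiction (indep u (¬NonZero⇒≡0 z) i) uᵢ≢0

  linComb-proportional : ∀ {u h} a → (∀ j → linComb F u B j ≡ a * linComb F h B j) →
                         ∀ i → u i ≡ a * h i
  linComb-proportional {u} {h} a u≡ah = λ i → x∙y⁻¹≈ε⇒x≈y _ _ (indep (λ i → u i - a * h i) difference≡0 i)
    where
    difference≡0 : ∀ j → linComb F (λ i → u i - a * h i) B j ≡ 0#
    difference≡0 j = begin
      linComb F (λ i → u i - a * h i) B j          ≡⟨ linComb-cong B (λ i → cong (u i +_) (-‿distribˡ-* a (h i))) j ⟩
      linComb F (λ i → u i + - a * h i) B j        ≡⟨ linComb-+ B u _ j ⟩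
      linComb F u B j + linComb F (λ i → - a * h i) B j
                                                  ≡⟨ cong₂ _+_ (u≡ah j) (linComb-• B (- a) h j) ⟩
      a * linComb F h B j + - a * linComb F h B j  ≡⟨ cong (a * linComb F h B j +_) (-‿distribˡ-* a _) ⟨
      a * linComb F h B j - a * linComb F h B j    ≡⟨ -‿inverseʳ _ ⟩
      0#                                          ∎
      where open ≡-Reasoning

  linComb-injective : ∀ {u v} → (∀ j → linComb F u B j ≡ linComb F v B j) → ∀ i → u i ≡ v i
  linComb-injective u≡v i =
    trans (linComb-proportional 1# (λ j → trans (u≡v j) (sym (*-identityˡ _))) i) (*-identityˡ _)

module StrongBlockingSets (F : Field) where
  open FieldProperties F
  open Duality F

  module Points {M m} {C : Code F M} (dim : HasDimension F C m) (minimal : IsMinimal F C) where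
    B : Fin m → Vect F M
    B = proj₁ dim
    B∈C : ∀ u → C (linComb F u B)
    B∈C = proj₁ (proj₂ dim)
    open Independence F (proj₂ (proj₂ (proj₂ dim)))

    column : Fin M → Vect F m
    column j ℓ = B ℓ j

    -- a zero column is replaced by the all-one vector; it never receives a nonzero coefficient
    pointFor : ∀ j → Dec (NonZero F (column j)) → Vect F m
    pointFor j (yes _) = column j
    pointFor j (no _)  = λ _ → 1#

    point : Fin M → Vect F m
    point j = pointFor j (nonZero? (column j))

    point≢0 : 0 ℕ.< m → ∀ j → NonZero F (point j)
    point≢0 0<m j with nonZero? (column j)
    ... | yes column≢0 = column≢0
    ... | no  _        = Fin.fromℕ< 0<m , 1≢0

    module _ (h : Vect F m) (h≢0 : NonZero F h) (v : Vect F m) (h·v≡0 : dot F h v ≡ 0#) where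

      inHFor : ∀ j → Dec (dot F h (column j) ≡ 0#) → Vect F m
      inHFor j (yes _) = column j
      inHFor j (no _)  = λ _ → 0#

      inH : Fin M → Vect F m
      inH j = inHFor j (dot F h (column j) ≟ 0#)

      coefficientFor : ∀ j → Carrier → Dec (dot F h (column j) ≡ 0#) → Dec (NonZero F (column j)) → Carrier
      coefficientFor j a (yes _) (yes _) = a
      coefficientFor j a _       _       = 0#

      coefficient-term : ∀ j a i d₁ d₂ → coefficientFor j a d₁ d₂ * pointFor j d₂ i ≡ a * inHFor j d₁ i
      coefficient-term j a i (yes _) (yes _)     = refl
      coefficient-term j a i (yes _) (no col≡0)  =
        trans (zeroˡ 1#) (sym (trans (cong (a *_) (¬NonZero⇒≡0 col≡0 i)) (zeroʳ a)))
      coefficient-term j a i (no _)  d₂          = trans (zeroˡ _) (sym (zeroʳ a))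

      coefficient-outside : ∀ j a d₁ d₂ → dot F h (pointFor j d₂) ≢ 0# → coefficientFor j a d₁ d₂ ≡ 0#
      coefficient-outside j a (yes inH) (yes _) outside = contradiction inH outside
      coefficient-outside j a (yes _)   (no _)  outside = refl
      coefficient-outside j a (no _)    d₂      outside = refl

      g⊥inH⇒g⊥column : ∀ g j (d : Dec (dot F h (column j) ≡ 0#)) →
                       dot F g (inHFor j d) ≡ 0# → dot F h (column j) ≡ 0# → dot F g (column j) ≡ 0#
      g⊥inH⇒g⊥column g j (yes _)   g⊥ _     = g⊥
      g⊥inH⇒g⊥column g j (no h·c≢0) _  h·c≡0 = contradiction h·c≡0 h·c≢0

      ¬separates : ∀ g → ¬ Separates g inH v
      ¬separates g (g⊥inH , g·v≡1) = 0≢1 (begin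
        0#                        ≡⟨ zeroʳ λ′ ⟨
        λ′ * 0#                   ≡⟨ cong (λ′ *_) h·v≡0 ⟨
        λ′ * dot F h v            ≡⟨ dot-•ˡ λ′ h v ⟨
        dot F (λ i → λ′ * h i) v  ≡⟨ sumF-cong (λ i → cong (_* v i) (g≡λ′h i)) ⟨
        dot F g v                 ≡⟨ g·v≡1 ⟩
        1#                        ∎)
        where
        open ≡-Reasoning
        g≢0 : NonZero F g
        g≢0 with nonZero? g
        ... | yes g≢0 = g≢0
        ... | no  g≡0 = contradiction
          (trans (sym (sumF-zero _ (λ i → trans (cong (_* v i) (¬NonZero⇒≡0 g≡0 i)) (zeroˡ (v i))))) g·v≡1) 0≢1
        supp-g⊆supp-h : _⊆σ_ F (linComb F g B) (linComb F h B)
        supp-g⊆supp-h j cᵍⱼ≢0 cʰⱼ≡0 =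
          cᵍⱼ≢0 (g⊥inH⇒g⊥column g j (dot F h (column j) ≟ 0#) (g⊥inH j) cʰⱼ≡0)
        proportional : ∃ λ λ′ → ∀ j → linComb F g B j ≡ λ′ * linComb F h B j
        proportional = minimal _ _ (B∈C h) (B∈C g) (nonZero-linComb h≢0) (nonZero-linComb g≢0) supp-g⊆supp-h
        λ′ : Carrier
        λ′ = proj₁ proportional
        g≡λ′h : ∀ i → g i ≡ λ′ * h i
        g≡λ′h = linComb-proportional λ′ (proj₂ proportional)

      spans : ∃ λ u → (∀ j → dot F h (point j) ≢ 0# → u j ≡ 0#) × (∀ i → v i ≡ linComb F u point i)
      spans with span⊎separates inH v
      ... | inj₂ (g , separates) = contradiction separates (¬separates g)
      ... | inj₁ (u , v≡Σ) =
        (λ j → coefficientFor j (u j) (d₁ j) (d₂ j)) ,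
        (λ j → coefficient-outside j (u j) (d₁ j) (d₂ j)) ,
        (λ i → trans (v≡Σ i) (sumF-cong (λ j → sym (coefficient-term j (u j) i (d₁ j) (d₂ j)))))
        where
        d₁ : ∀ j → Dec (dot F h (column j) ≡ 0#)
        d₁ j = dot F h (column j) ≟ 0#
        d₂ : ∀ j → Dec (NonZero F (column j))
        d₂ j = nonZero? (column j)

  minimal⇒strongBlockingSet : ∀ {M m} {C : Code F M} → HasDimension F C m → IsMinimal F C → 0 ℕ.< m →
                              Σ (Fin M → Vect F m) (IsStrongBlockingSet F)
  minimal⇒strongBlockingSet dim minimal 0<m = point , point≢0 0<m , spans
    where open Points dim minimal

module Polynomials (F : Field) where
  open FieldProperties F
  open import Algebra.Definitions.RawSemiring (Semiring.rawSemiring semiring) using (_^_)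

  -- a polynomial with m coefficients, constant term first
  Poly : ℕ → Set
  Poly m = Fin m → Carrier

  eval : ∀ {m} → Poly m → Carrier → Carrier
  eval {zero}  u x = 0#
  eval {suc m} u x = head u + x * eval (tail u) x

  eval≡∑ : ∀ {m} (u : Poly m) x → sumF F (λ t → u t * x ^ toℕ t) ≡ eval u x
  eval≡∑ {zero}  u x = refl
  eval≡∑ {suc m} u x = cong₂ _+_ (*-identityʳ (u zero)) (begin
    sumF F (λ t → u (suc t) * (x * x ^ toℕ t))   ≡⟨ sumF-cong (λ t → x*[y*z]≡y*[x*z] (u (suc t)) x _) ⟩
    sumF F (λ t → x * (u (suc t) * x ^ toℕ t))   ≡⟨ *-distribˡ-sumF x (λ t → u (suc t) * x ^ toℕ t) ⟨
    x * sumF F (λ t → u (suc t) * x ^ toℕ t)     ≡⟨ cong (x *_) (eval≡∑ (tail u) x) ⟩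
    x * eval (tail u) x                          ∎)
    where open ≡-Reasoning

  eval-init : ∀ {m} (u : Poly (suc m)) x → last u ≡ 0# → eval u x ≡ eval (init u) x
  eval-init {zero}  u x u₀≡0 = trans (cong (_+ x * 0#) u₀≡0) (trans (+-identityˡ _) (zeroʳ x))
  eval-init {suc m} u x last≡0 = cong (λ y → u zero + x * y) (eval-init (tail u) x last≡0)

  last≡0∧init≡0⇒≡0 : ∀ {m} (u : Poly (suc m)) → last u ≡ 0# → (∀ t → init u t ≡ 0#) → ∀ t → u t ≡ 0#
  last≡0∧init≡0⇒≡0 {zero}  u last≡0 init≡0 zero    = last≡0
  last≡0∧init≡0⇒≡0 {suc m} u last≡0 init≡0 zero    = init≡0 zero
  last≡0∧init≡0⇒≡0 {suc m} u last≡0 init≡0 (suc t) = last≡0∧init≡0⇒≡0 (tail u) last≡0 (init≡0 ∘ suc) t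

  -- synthetic division by x - β
  quotient : ∀ {m} → Poly (suc m) → Carrier → Poly m
  quotient {suc m} u β zero    = eval (tail u) β
  quotient {suc m} u β (suc t) = quotient (tail u) β t

  factor-theorem : ∀ {m} (u : Poly (suc m)) β x →
                   eval u x ≡ (x - β) * eval (quotient u β) x + eval u β
  factor-theorem {zero} u β x = begin
    u zero + x * 0#                    ≡⟨ cong (u zero +_) (zeroʳ x) ⟩
    u zero + 0#                        ≡⟨ cong (u zero +_) (zeroʳ β) ⟨
    u zero + β * 0#                    ≡⟨ +-identityˡ _ ⟨
    0# + (u zero + β * 0#)             ≡⟨ cong (_+ (u zero + β * 0#)) (zeroʳ (x - β)) ⟨
    (x - β) * 0# + (u zero + β * 0#)   ∎
    where open ≡-Reasoning
  factor-theorem {suc m} u β x = begin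
    u₀ + x * eval (tail u) x        ≡⟨ cong (λ y → u₀ + x * y) (factor-theorem (tail u) β x) ⟩
    u₀ + x * (d * Q + W)            ≡⟨ cong (u₀ +_) x[dQ+W]≡d[W+xQ]+βW ⟩
    u₀ + (d * (W + x * Q) + β * W)  ≡⟨ x+[y+z]≡y+[x+z] u₀ _ _ ⟩
    d * (W + x * Q) + (u₀ + β * W)  ∎
    where
    open ≡-Reasoning
    u₀ d Q W : Carrier
    u₀ = u zero
    d = x - β
    Q = eval (quotient (tail u) β) x
    W = eval (tail u) β
    x≡d+β : x ≡ d + β
    x≡d+β = sym (trans (+-assoc x (- β) β) (trans (cong (x +_) (-‿inverseˡ β)) (+-identityʳ x)))
    x[dQ+W]≡d[W+xQ]+βW : x * (d * Q + W) ≡ d * (W + x * Q) + β * W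
    x[dQ+W]≡d[W+xQ]+βW = begin
      x * (d * Q + W)                ≡⟨ distribˡ x (d * Q) W ⟩
      x * (d * Q) + x * W            ≡⟨ cong₂ _+_ (x*[y*z]≡y*[x*z] x d Q) (cong (_* W) x≡d+β) ⟩
      d * (x * Q) + (d + β) * W      ≡⟨ cong (d * (x * Q) +_) (distribʳ W d β) ⟩
      d * (x * Q) + (d * W + β * W)  ≡⟨ +-assoc _ _ _ ⟨
      (d * (x * Q) + d * W) + β * W  ≡⟨ cong (_+ β * W) (trans (+-comm _ _) (sym (distribˡ d W (x * Q)))) ⟩
      d * (W + x * Q) + β * W        ∎

  quotient≡0⇒≡0 : ∀ {m} (u : Poly (suc m)) β →
                  (∀ t → quotient u β t ≡ 0#) → eval u β ≡ 0# → ∀ t → u t ≡ 0#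
  quotient≡0⇒≡0 {zero} u β _ root zero =
    trans (sym (trans (cong (u zero +_) (zeroʳ β)) (+-identityʳ _))) root
  quotient≡0⇒≡0 {suc m} u β q≡0 root = λ { zero → u₀≡0 ; (suc t) → tail≡0 t }
    where
    tail≡0 : ∀ t → u (suc t) ≡ 0#
    tail≡0 = quotient≡0⇒≡0 (tail u) β (q≡0 ∘ suc) (q≡0 zero)
    u₀≡0 : u zero ≡ 0#
    u₀≡0 = begin
      u zero                              ≡⟨ +-identityʳ _ ⟨
      u zero + 0#                         ≡⟨ cong (u zero +_) (zeroʳ β) ⟨
      u zero + β * 0#                     ≡⟨ cong (λ y → u zero + β * y) (q≡0 zero) ⟨
      u zero + β * eval (tail u) β        ≡⟨ root ⟩
      0#                                  ∎
      where open ≡-Reasoning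

  roots⇒≡0 : ∀ {m} (u : Poly m) (α : Fin m → Carrier) → Injective _≡_ _≡_ α →
             (∀ i → eval u (α i) ≡ 0#) → ∀ t → u t ≡ 0#
  roots⇒≡0 {suc m} u α α-inj roots =
    quotient≡0⇒≡0 u (α zero) (roots⇒≡0 _ (α ∘ suc) (Fin.suc-injective ∘ α-inj) quotient-roots) (roots zero)
    where
    quotient-roots : ∀ i → eval (quotient u (α zero)) (α (suc i)) ≡ 0#
    quotient-roots i with x*y≡0⇒x≡0⊎y≡0 (α (suc i) - α zero) q (begin
      (α (suc i) - α zero) * q             ≡⟨ +-identityʳ _ ⟨
      (α (suc i) - α zero) * q + 0#        ≡⟨ cong ((α (suc i) - α zero) * q +_) (roots zero) ⟨
      (α (suc i) - α zero) * q + eval u (α zero)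
                                          ≡⟨ factor-theorem u (α zero) (α (suc i)) ⟨
      eval u (α (suc i))                   ≡⟨ roots (suc i) ⟩
      0#                                   ∎)
      where
      open ≡-Reasoning
      q : Carrier
      q = eval (quotient u (α zero)) (α (suc i))
    ... | inj₁ αᵢ-α₀≡0 = contradiction (α-inj (x∙y⁻¹≈ε⇒x≈y _ _ αᵢ-α₀≡0)) λ ()
    ... | inj₂ q≡0     = q≡0

  fewRoots : ∀ {m L} (u : Poly m) → NonZero F u → (α : Fin L → Carrier) → Injective _≡_ _≡_ α →
             count (λ j → eval u (α j) ≟ 0#) ℕ.< m
  fewRoots {m} u (t , uₜ≢0) α α-inj with m ℕ.≤? count (λ j → eval u (α j) ≟ 0#)
  ... | no  m≰roots = ℕ.≰⇒> m≰roots
  ... | yes m≤roots =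
    let r , r-inj , roots = count-enumerate (λ j → eval u (α j) ≟ 0#) m≤roots
    in contradiction (roots⇒≡0 u (α ∘ r) (r-inj ∘ α-inj) roots t) uₜ≢0

module ReedSolomon (F : Field) {K′ r} (α : Fin (K′ ℕ.+ r) → Field.Carrier F)
                   (α-inj : Injective _≡_ _≡_ α) where
  open FieldProperties F
  open Polynomials F
  open import Algebra.Definitions.RawSemiring (Semiring.rawSemiring semiring) using (_^_)

  -- the extended code: position zero records the coefficient of x ^ K′
  row : Fin (suc K′) → Vect F (suc (K′ ℕ.+ r))
  row t zero    = single (Fin.fromℕ K′) 1# t
  row t (suc j) = α j ^ toℕ t

  RS : Code F (suc (K′ ℕ.+ r))
  RS c = ∃ λ u → ∀ j → c j ≡ linComb F u row j

  codeword-zero : ∀ u → linComb F u row zero ≡ last u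
  codeword-zero u = trans (sumF-cong (λ t → *-comm (u t) (row t zero)))
                          (trans (dot-single (Fin.fromℕ K′) 1# u) (*-identityˡ (last u)))

  codeword-suc : ∀ u j → linComb F u row (suc j) ≡ eval u (α j)
  codeword-suc u j = eval≡∑ u (α j)

  roots : ∀ {m} → Poly m → ℕ
  roots u = count (λ j → eval u (α j) ≟ 0#)

  zeros≡𝟙+roots : ∀ {c} u → (∀ j → c j ≡ linComb F u row j) → zeros c ≡ 𝟙 (c zero ≟ 0#) ℕ.+ roots u
  zeros≡𝟙+roots u c≡ = cong (𝟙 _ ℕ.+_) (zeros-cong (λ j → trans (c≡ (suc j)) (codeword-suc u j)))

  RS-linear : IsLinear F RS
  RS-linear = record
    { has-0    = (λ _ → 0#) , λ j → sym (linComb-zero row j)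
    ; closed-+ = λ { (u , c≡) (u′ , c′≡) → (λ t → u t + u′ t) , λ j →
                     trans (cong₂ _+_ (c≡ j) (c′≡ j)) (sym (linComb-+ row u u′ j)) }
    ; closed-• = λ a → λ { (u , c≡) → (λ t → a * u t) , λ j →
                     trans (cong (a *_) (c≡ j)) (sym (linComb-• row a u j)) }
    }

  RS-independent : ∀ u → (∀ j → linComb F u row j ≡ 0#) → ∀ t → u t ≡ 0#
  RS-independent u c≡0 = last≡0∧init≡0⇒≡0 u last≡0 (roots⇒≡0 (init u) (α ∘ (_↑ˡ r)) α↑-inj init-roots)
    where
    last≡0 : last u ≡ 0#
    last≡0 = trans (sym (codeword-zero u)) (c≡0 zero)
    α↑-inj : Injective _≡_ _≡_ (α ∘ (_↑ˡ r))
    α↑-inj = Fin.↑ˡ-injective r _ _ ∘ α-inj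
    init-roots : ∀ i → eval (init u) (α (i ↑ˡ r)) ≡ 0#
    init-roots i = trans (sym (eval-init u _ last≡0)) (trans (sym (codeword-suc u (i ↑ˡ r))) (c≡0 (suc (i ↑ˡ r))))

  RS-dimension : HasDimension F RS (suc K′)
  RS-dimension = row , (λ u → u , λ j → refl) , (λ c c∈RS → c∈RS) , RS-independent

  zeros≤K′ : ∀ c → RS c → NonZero F c → zeros c ℕ.≤ K′
  zeros≤K′ c (u , c≡) c≢0 with last u ≟ 0#
  ... | no last≢0 = begin
    zeros c                      ≡⟨ zeros≡𝟙+roots u c≡ ⟩
    𝟙 (c zero ≟ 0#) ℕ.+ roots u  ≡⟨ cong (ℕ._+ roots u) (𝟙-no (c zero ≟ 0#) (last≢0 ∘ trans (sym c₀≡last))) ⟩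
    roots u                      ≤⟨ ℕ.s≤s⁻¹ (fewRoots u (Fin.fromℕ K′ , last≢0) α α-inj) ⟩
    K′                           ∎
    where
    open ℕ.≤-Reasoning
    c₀≡last : c zero ≡ last u
    c₀≡last = trans (c≡ zero) (codeword-zero u)
  ... | yes last≡0 = begin
    zeros c                      ≡⟨ zeros≡𝟙+roots u c≡ ⟩
    𝟙 (c zero ≟ 0#) ℕ.+ roots u  ≤⟨ ℕ.+-monoˡ-≤ _ (𝟙≤1 (c zero ≟ 0#)) ⟩
    suc (roots u)                ≡⟨ cong suc (count-cong _ _ (λ {j} → trans (sym (eval-init u (α j) last≡0)))
                                                              (λ {j} → trans (eval-init u (α j) last≡0))) ⟩
    suc (roots (init u))         ≤⟨ fewRoots (init u) init≢0 α α-inj ⟩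
    K′                           ∎
    where
    open ℕ.≤-Reasoning
    init≢0 : NonZero F (init u)
    init≢0 with nonZero? (init u)
    ... | yes init≢0 = init≢0
    ... | no  init≡0 = contradiction (λ j → trans (c≡ j) (trans (linComb-cong row u≡0 j) (linComb-zero row j)))
                                     (λ c≡0 → let i , cᵢ≢0 = c≢0 in cᵢ≢0 (c≡0 i))
      where
      u≡0 : ∀ t → u t ≡ 0#
      u≡0 = last≡0∧init≡0⇒≡0 u last≡0 (¬NonZero⇒≡0 init≡0)

module FieldHom {F E : Field} {ι : Field.Carrier F → Field.Carrier E} (hom : IsFieldHom F E ι) where
  private
    module 𝔽 = FieldProperties F
    module 𝔼 = FieldProperties E
  open IsFieldHom hom public

  ι-0 : ι 𝔽.0# ≡ 𝔼.0#
  ι-0 = 𝔼.x+x≈x⇒x≈0 _ (trans (sym (hom-+ 𝔽.0# 𝔽.0#)) (cong ι (𝔽.+-identityˡ 𝔽.0#)))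

  ι-neg : ∀ a → ι (𝔽.- a) ≡ 𝔼.- ι a
  ι-neg a = 𝔼.inverseˡ-unique _ _ (trans (sym (hom-+ (𝔽.- a) a)) (trans (cong ι (𝔽.-‿inverseˡ a)) ι-0))

module Combinations {F E : Field} {ι : Field.Carrier F → Field.Carrier E} (hom : IsFieldHom F E ι) where
  private
    module 𝔽 = FieldProperties F
    module 𝔼 = FieldProperties E
  open FieldHom hom

  combination : ∀ {s} → (Fin s → 𝔼.Carrier) → (Fin s → 𝔽.Carrier) → 𝔼.Carrier
  combination b u = sumF E (λ t → ι (u t) 𝔼.* b t)

  module _ {s} (b : Fin s → 𝔼.Carrier) where

    combination-cong : ∀ {u v} → u ≗ v → combination b u ≡ combination b v
    combination-cong u≗v = 𝔼.sumF-cong (λ t → cong (λ a → ι a 𝔼.* b t) (u≗v t))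

    combination-+ : ∀ u v → combination b (λ t → u t 𝔽.+ v t) ≡ combination b u 𝔼.+ combination b v
    combination-+ u v = trans (𝔼.sumF-cong (λ t → trans (cong (𝔼._* b t) (hom-+ (u t) (v t))) (𝔼.distribʳ (b t) _ _)))
                              (𝔼.sumF-+ (λ t → ι (u t) 𝔼.* b t) (λ t → ι (v t) 𝔼.* b t))

    combination-• : ∀ a u → combination b (λ t → a 𝔽.* u t) ≡ ι a 𝔼.* combination b u
    combination-• a u = trans (𝔼.sumF-cong (λ t → trans (cong (𝔼._* b t) (hom-* a (u t))) (𝔼.*-assoc _ _ _)))
                              (sym (𝔼.*-distribˡ-sumF (ι a) (λ t → ι (u t) 𝔼.* b t)))

    Independent : Set
    Independent = ∀ u → combination b u ≡ 𝔼.0# → ∀ t → u t ≡ 𝔽.0#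

    InSpan : 𝔼.Carrier → Set
    InSpan x = ∃ λ u → x ≡ combination b u

    combination-injective : Independent → ∀ u v → combination b u ≡ combination b v → u ≗ v
    combination-injective independent u v cu≡cv t =
      𝔽.x∙y⁻¹≈ε⇒x≈y _ _ (trans (cong (u t 𝔽.+_) (sym (𝔽.-1*x≈-x (v t)))) (independent w w≡0 t))
      where
      w : Fin s → 𝔽.Carrier
      w t = u t 𝔽.+ 𝔽.- 𝔽.1# 𝔽.* v t
      w≡0 : combination b w ≡ 𝔼.0#
      w≡0 = begin
        combination b w                                  ≡⟨ combination-+ u _ ⟩
        Σu 𝔼.+ combination b (λ t → 𝔽.- 𝔽.1# 𝔽.* v t)     ≡⟨ cong (Σu 𝔼.+_) (combination-• _ v) ⟩
        Σu 𝔼.+ ι (𝔽.- 𝔽.1#) 𝔼.* Σv                        ≡⟨ cong (λ y → Σu 𝔼.+ y 𝔼.* Σv) (trans (ι-neg 𝔽.1#) (cong 𝔼.-_ hom-1)) ⟩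
        Σu 𝔼.+ 𝔼.- 𝔼.1# 𝔼.* Σv                            ≡⟨ cong (Σu 𝔼.+_) (𝔼.-1*x≈-x Σv) ⟩
        Σu 𝔼.- Σv                                        ≡⟨ 𝔼.x≈y⇒x∙y⁻¹≈ε cu≡cv ⟩
        𝔼.0#                                             ∎
        where
        open ≡-Reasoning
        Σu Σv : 𝔼.Carrier
        Σu = combination b u
        Σv = combination b v

  extend-independent : ∀ {s} {b : Fin s → 𝔼.Carrier} {x} → Independent b → ¬ InSpan b x → Independent (x ∷ b)
  extend-independent {b = b} {x} independent x∉span u cu≡0 with u zero 𝔽.≟ 𝔽.0#
  ... | yes u₀≡0 = λ { zero → u₀≡0 ; (suc t) → independent (tail u) tail≡0 t }
    where
    tail≡0 : combination b (tail u) ≡ 𝔼.0#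
    tail≡0 = begin
      combination b (tail u)                        ≡⟨ 𝔼.+-identityˡ _ ⟨
      𝔼.0# 𝔼.+ combination b (tail u)               ≡⟨ cong (𝔼._+ combination b (tail u)) ι[u₀]*x≡0 ⟨
      ι (u zero) 𝔼.* x 𝔼.+ combination b (tail u)   ≡⟨ cu≡0 ⟩
      𝔼.0#                                         ∎
      where
      open ≡-Reasoning
      ι[u₀]*x≡0 : ι (u zero) 𝔼.* x ≡ 𝔼.0#
      ι[u₀]*x≡0 = trans (cong (𝔼._* x) (trans (cong ι u₀≡0) ι-0)) (𝔼.zeroˡ x)
  ... | no  u₀≢0 = contradiction (c′ , x≡) x∉span
    where
    c : 𝔽.Carrier
    c = u zero 𝔽.⁻¹
    c′ : Fin _ → 𝔽.Carrier
    c′ t = 𝔽.- c 𝔽.* u (suc t)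
    x≡ : x ≡ combination b c′
    x≡ = begin
      x                                         ≡⟨ 𝔼.*-identityˡ x ⟨
      𝔼.1# 𝔼.* x                                 ≡⟨ cong (𝔼._* x) (trans (cong ι (𝔽.⁻¹-inverseˡ _ u₀≢0)) hom-1) ⟨
      ι (c 𝔽.* u zero) 𝔼.* x                      ≡⟨ trans (cong (𝔼._* x) (hom-* c (u zero))) (𝔼.*-assoc _ _ _) ⟩
      ι c 𝔼.* (ι (u zero) 𝔼.* x)                  ≡⟨ cong (ι c 𝔼.*_) (𝔼.inverseˡ-unique _ _ cu≡0) ⟩
      ι c 𝔼.* 𝔼.- combination b (tail u)          ≡⟨ 𝔼.-‿distribʳ-* _ _ ⟨
      𝔼.- (ι c 𝔼.* combination b (tail u))        ≡⟨ 𝔼.-‿distribˡ-* _ _ ⟩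
      𝔼.- ι c 𝔼.* combination b (tail u)          ≡⟨ cong (𝔼._* combination b (tail u)) (ι-neg c) ⟨
      ι (𝔽.- c) 𝔼.* combination b (tail u)        ≡⟨ combination-• b (𝔽.- c) (tail u) ⟨
      combination b c′                          ∎
      where open ≡-Reasoning

module _ (F : Field) {q} (|F|≡q : HasOrder F q) where
  open FieldProperties F
  private module |F| = Inverse |F|≡q

  2≤order : 2 ℕ.≤ q
  2≤order = Fin.injective⇒≤ injective
    where
    zeroOne : Fin 2 → Fin q
    zeroOne zero    = |F|.to 0#
    zeroOne (suc _) = |F|.to 1#
    0≢1′ : |F|.to 0# ≢ |F|.to 1#
    0≢1′ = 0≢1 ∘ Injection.injective (↔⇒↣ |F|≡q)
    injective : Injective _≡_ _≡_ zeroOne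
    injective {zero}     {zero}     _  = refl
    injective {zero}     {suc zero} eq = contradiction eq 0≢1′
    injective {suc zero} {zero}     eq = contradiction (sym eq) 0≢1′
    injective {suc zero} {suc zero} _  = refl

  vectorAt : ∀ s → Fin (q ℕ.^ s) → Fin s → Carrier
  vectorAt s x t = |F|.from (Fin.finToFun {q} {s} x t)

  indexOf : ∀ {s} → (Fin s → Carrier) → Fin (q ℕ.^ s)
  indexOf {s} u = Fin.funToFin {s} {q} (|F|.to ∘ u)

  vectorAt-indexOf : ∀ {s} (u : Fin s → Carrier) → vectorAt s (indexOf u) ≗ u
  vectorAt-indexOf {s} u t =
    trans (cong |F|.from (Fin.finToFun-funToFin {s} {q} (|F|.to ∘ u) t)) (|F|.strictlyInverseʳ (u t))

  indexOf-injective : ∀ {s} {u v : Fin s → Carrier} → indexOf u ≡ indexOf v → u ≗ v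
  indexOf-injective {s} {u} {v} eq t =
    trans (sym (vectorAt-indexOf u t)) (trans (cong (λ i → vectorAt s i t) eq) (vectorAt-indexOf v t))

  vectorAt-injective : ∀ s {x y : Fin (q ℕ.^ s)} → vectorAt s x ≗ vectorAt s y → x ≡ y
  vectorAt-injective s {x} {y} x≗y = begin
    x                                              ≡⟨ Fin.funToFin-finToFin {s} {q} x ⟨
    Fin.funToFin (Fin.finToFun {q} {s} x)          ≡⟨ funToFin-cong (Injection.injective (↔⇒↣ (↔-sym |F|≡q)) ∘ x≗y) ⟩
    Fin.funToFin (Fin.finToFun {q} {s} y)          ≡⟨ Fin.funToFin-finToFin {s} {q} y ⟩
    y                                              ∎
    where
    open ≡-Reasoning
    funToFin-cong : ∀ {m n} {f g : Fin m → Fin n} → f ≗ g → Fin.funToFin f ≡ Fin.funToFin g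
    funToFin-cong {zero}  f≗g = refl
    funToFin-cong {suc m} f≗g = cong₂ combine (f≗g zero) (funToFin-cong (f≗g ∘ suc))

module Extension {F E : Field} {ι : Field.Carrier F → Field.Carrier E} (hom : IsFieldHom F E ι)
                 {q k} (|F|≡q : HasOrder F q) (|E|≡q^k : HasOrder E (q ℕ.^ k)) where
  private
    module 𝔽 = FieldProperties F
    module 𝔼 = FieldProperties E
    module |E| = Inverse |E|≡q^k
  open Combinations hom

  independent⇒q^s≤q^k : ∀ {s} {b : Fin s → 𝔼.Carrier} → Independent b → q ℕ.^ s ℕ.≤ q ℕ.^ k
  independent⇒q^s≤q^k {s} {b} independent = Fin.injective⇒≤ {f = |E|.to ∘ combination b ∘ vectorAt F |F|≡q s}
    ( vectorAt-injective F |F|≡q s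
    ∘ combination-injective b independent _ _
    ∘ Injection.injective (↔⇒↣ |E|≡q^k))

  spanning⇒q^k≤q^s : ∀ {s} {b : Fin s → 𝔼.Carrier} → (∀ x → InSpan b x) → q ℕ.^ k ℕ.≤ q ℕ.^ s
  spanning⇒q^k≤q^s {s} {b} spans = Fin.injective⇒≤ {f = indexOf F |F|≡q ∘ coordinates ∘ |E|.from} injective
    where
    coordinates : 𝔼.Carrier → Fin s → 𝔽.Carrier
    coordinates x = proj₁ (spans x)
    injective : Injective _≡_ _≡_ (indexOf F |F|≡q ∘ coordinates ∘ |E|.from)
    injective {y} {y′} eq = Injection.injective (↔⇒↣ (↔-sym |E|≡q^k)) (begin
      |E|.from y                              ≡⟨ proj₂ (spans (|E|.from y)) ⟩
      combination b (coordinates (|E|.from y))  ≡⟨ combination-cong b (indexOf-injective F |F|≡q eq) ⟩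
      combination b (coordinates (|E|.from y′)) ≡⟨ proj₂ (spans (|E|.from y′)) ⟨
      |E|.from y′                             ∎)
      where open ≡-Reasoning

  inSpan? : ∀ {s} (b : Fin s → 𝔼.Carrier) → Decidable (InSpan b)
  inSpan? {s} b x with Fin.any? (λ i → x 𝔼.≟ combination b (vectorAt F |F|≡q s i))
  ... | yes (i , x≡) = yes (vectorAt F |F|≡q s i , x≡)
  ... | no  ¬any     = no λ (u , x≡) →
    ¬any (indexOf F |F|≡q u , trans x≡ (combination-cong b (sym ∘ vectorAt-indexOf F |F|≡q u)))

  private
    1<q : 1 ℕ.< q
    1<q = 2≤order F |F|≡q

  independentFamily : ∀ s → s ℕ.≤ k → Σ (Fin s → 𝔼.Carrier) Independent
  independentFamily zero    _   = (λ ()) , λ _ _ ()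
  independentFamily (suc s) s<k with independentFamily s (ℕ.<⇒≤ s<k)
  ... | b , independent with Fin.any? (λ y → ¬? (inSpan? b (|E|.from y)))
  ...   | yes (y , y∉span) = |E|.from y ∷ b , extend-independent {b = b} independent y∉span
  ...   | no  ¬any = contradiction (spanning⇒q^k≤q^s spans) (ℕ.<⇒≱ (ℕ.^-monoʳ-< q 1<q s<k))
    where
    spans : ∀ x → InSpan b x
    spans x = decidable-stable (inSpan? b x) λ x∉span →
      ¬any (|E|.to x , subst (¬_ ∘ InSpan b) (sym (|E|.strictlyInverseʳ x)) x∉span)

  basis : Σ (Fin k → 𝔼.Carrier) λ b → Independent b × (∀ x → InSpan b x)
  basis = b , independent , spans
    where
    b : Fin k → 𝔼.Carrier
    b = proj₁ (independentFamily k ℕ.≤-refl)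
    independent : Independent b
    independent = proj₂ (independentFamily k ℕ.≤-refl)
    spans : ∀ x → InSpan b x
    spans x = decidable-stable (inSpan? b x) λ x∉span →
      ℕ.<⇒≱ (ℕ.^-monoʳ-< q 1<q (ℕ.n<1+n k))
            (independent⇒q^s≤q^k {b = x ∷ b} (extend-independent independent x∉span))

module Concatenation {F E : Field} {ι : Field.Carrier F → Field.Carrier E} (hom : IsFieldHom F E ι)
  {n} (π : Field.Carrier E → Vect F n)
  (π-+ : ∀ x y j → π (Field._+_ E x y) j ≡ Field._+_ F (π x j) (π y j))
  (π-• : ∀ a x j → π (Field._*_ E (ι a) x) j ≡ Field._*_ F a (π x j))
  (π-injective : ∀ x y → (∀ j → π x j ≡ π y j) → x ≡ y)
  {N} (C : Code E N) where
  private
    module 𝔽 = FieldProperties F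
    module 𝔼 = FieldProperties E
  open FieldHom hom
  open Combinations hom

  W : Code F (N ℕ.* n)
  W = concat F E ι π C

  π-0 : ∀ j → π 𝔼.0# j ≡ 𝔽.0#
  π-0 j = 𝔽.x+x≈x⇒x≈0 _ (trans (sym (π-+ 𝔼.0# 𝔼.0# j)) (cong (λ x → π x j) (𝔼.+-identityˡ 𝔼.0#)))

  π≡0⇒≡0 : ∀ x → (∀ j → π x j ≡ 𝔽.0#) → x ≡ 𝔼.0#
  π≡0⇒≡0 x πx≡0 = π-injective x 𝔼.0# (λ j → trans (πx≡0 j) (sym (π-0 j)))

  π-nonZero : ∀ {x} → x ≢ 𝔼.0# → NonZero F (π x)
  π-nonZero {x} x≢0 with 𝔽.nonZero? (π x)
  ... | yes πx≢0 = πx≢0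
  ... | no  πx≡0 = contradiction (π≡0⇒≡0 x (𝔽.¬NonZero⇒≡0 πx≡0)) x≢0

  π-sum : ∀ {m} (g : Fin m → 𝔼.Carrier) j → π (sumF E g) j ≡ sumF F (λ i → π (g i) j)
  π-sum {zero}  g j = π-0 j
  π-sum {suc m} g j = trans (π-+ (g zero) _ j) (cong (π (g zero) j 𝔽.+_) (π-sum (g ∘ suc) j))

  expand : Vect E N → Vect F (N ℕ.* n)
  expand c i = π (c (proj₁ (remQuot {N} n i))) (proj₂ (remQuot {N} n i))

  expand-combine : ∀ c a (b : Fin n) → expand c (combine a b) ≡ π (c a) b
  expand-combine c a b = cong (λ (a , b) → π (c a) b) (Fin.remQuot-combine {N} {n} a b)

  concat-linear : IsLinear E C → IsLinear F W
  concat-linear linear = record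
    { has-0    = (λ _ → 𝔼.0#) , has-0 , (λ i → sym (π-0 _))
    ; closed-+ = λ { (c , c∈C , w≗) (c′ , c′∈C , w′≗) → (λ a → c a 𝔼.+ c′ a) , closed-+ c∈C c′∈C ,
                     λ i → trans (cong₂ 𝔽._+_ (w≗ i) (w′≗ i)) (sym (π-+ _ _ _)) }
    ; closed-• = λ a → λ { (c , c∈C , w≗) → (λ x → ι a 𝔼.* c x) , closed-• (ι a) c∈C ,
                     λ i → trans (cong (a 𝔽.*_) (w≗ i)) (sym (π-• a _ _)) }
    }
    where open IsLinear linear

  block : Vect F (N ℕ.* n) → Fin N → Vect F n
  block w a b = w (combine a b)

  wt-blocks : (w : Vect F (N ℕ.* n)) → wt F w ≡ ∑[ a < N ] wt F (block w a)
  wt-blocks w = begin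
    wt F w                                                 ≡⟨ 𝔽.wt≡count w ⟩
    count (λ i → ¬? (w i 𝔽.≟ 𝔽.0#))                         ≡⟨ count-combine N (λ i → ¬? (w i 𝔽.≟ 𝔽.0#)) ⟩
    ∑[ a < N ] count (λ b → ¬? (block w a b 𝔽.≟ 𝔽.0#))      ≡⟨ ℕ∑.sum-cong-≗ (λ a → 𝔽.wt≡count (block w a)) ⟨
    ∑[ a < N ] wt F (block w a)                            ∎
    where open ≡-Reasoning

  concat-minDist : ∀ {I : Code F n} D d → (∀ x → I (π x)) →
                   MinDistAtLeast E C D → MinDistAtLeast F I d → MinDistAtLeast F W (D ℕ.* d)
  concat-minDist D d π∈I C-dist I-dist w (c , c∈C , w≗) (i , wᵢ≢0) = begin
    D ℕ.* d                                  ≤⟨ ℕ.*-monoˡ-≤ d (C-dist c c∈C (a , cₐ≢0)) ⟩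
    wt E c ℕ.* d                              ≡⟨ cong (ℕ._* d) (𝔼.wt≡count c) ⟩
    count (λ a → ¬? (c a 𝔼.≟ 𝔼.0#)) ℕ.* d      ≤⟨ count-weighted _ _ d block-weight ⟩
    ∑[ a < N ] wt F (block w a)              ≡⟨ wt-blocks w ⟨
    wt F w                                   ∎
    where
    open ℕ.≤-Reasoning
    a : Fin N
    a = proj₁ (remQuot {N} n i)
    cₐ≢0 : c a ≢ 𝔼.0#
    cₐ≢0 cₐ≡0 = wᵢ≢0 (trans (w≗ i) (trans (cong (λ x → π x _) cₐ≡0) (π-0 _)))
    block-weight : ∀ a → c a ≢ 𝔼.0# → d ℕ.≤ wt F (block w a)
    block-weight a cₐ≢0 = subst (d ℕ.≤_) (𝔽.wt-cong (λ b → sym (trans (w≗ _) (expand-combine c a b))))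
                                (I-dist (π (c a)) (π∈I (c a)) (π-nonZero cₐ≢0))

  module _ {I : Code F n} (π∈I : ∀ x → I (π x)) (I-minimal : IsMinimal F I) where

    blockwise-proportional : ∀ {w w′ c c′} → w ≗ expand c → w′ ≗ expand c′ → _⊆σ_ F w′ w →
                             ∀ a → ∃ λ ℓ → c′ a ≡ ι ℓ 𝔼.* c a
    blockwise-proportional {w} {w′} {c} {c′} w≗ w′≗ w′⊆w a with c′ a 𝔼.≟ 𝔼.0#
    ... | yes c′ₐ≡0 = 𝔽.0# , trans c′ₐ≡0 (sym (trans (cong (𝔼._* c a) ι-0) (𝔼.zeroˡ (c a))))
    ... | no  c′ₐ≢0 =
      let ℓ , πc′ₐ≡ℓπcₐ = I-minimal _ _ (π∈I (c a)) (π∈I (c′ a)) πcₐ≢0 πc′ₐ≢0 πc′ₐ⊆πcₐ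
      in ℓ , π-injective _ _ (λ b → trans (πc′ₐ≡ℓπcₐ b) (sym (π-• ℓ (c a) b)))
      where
      entry : ∀ {v x} → v ≗ expand x → ∀ b → v (combine a b) ≡ π (x a) b
      entry {x = x} v≗ b = trans (v≗ (combine a b)) (expand-combine x a b)
      πc′ₐ⊆πcₐ : _⊆σ_ F (π (c′ a)) (π (c a))
      πc′ₐ⊆πcₐ b πc′ₐb≢0 πcₐb≡0 =
        w′⊆w (combine a b) (πc′ₐb≢0 ∘ trans (sym (entry w′≗ b))) (trans (entry w≗ b) πcₐb≡0)
      πc′ₐ≢0 : NonZero F (π (c′ a))
      πc′ₐ≢0 = π-nonZero c′ₐ≢0
      πcₐ≢0 : NonZero F (π (c a))
      πcₐ≢0 = let b , πc′ₐb≢0 = πc′ₐ≢0 in b , λ πcₐb≡0 → πc′ₐ⊆πcₐ b πc′ₐb≢0 πcₐb≡0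

    concat-minimal : ∀ {q K′} → HasOrder F q → IsLinear E C →
                     (∀ c → C c → NonZero E c → 𝔼.zeros c ℕ.≤ K′) → q ℕ.* K′ ℕ.< N → IsMinimal F W
    concat-minimal {q} {K′} |F|≡q linear fewZeros qK′<N w w′ (c , c∈C , w≗) (c′ , c′∈C , w′≗) _ _ w′⊆w =
      λ′ , w′≡λ′w
      where
      module |F| = Inverse |F|≡q
      factor : ∀ a → ∃ λ ℓ → c′ a ≡ ι ℓ 𝔼.* c a
      factor = blockwise-proportional w≗ w′≗ w′⊆w
      ℓ : Fin N → 𝔽.Carrier
      ℓ a = proj₁ (factor a)
      -- pigeonhole: more than q K′ blocks, but only q possible factors
      fibre : ∃ λ v → K′ ℕ.< count (λ a → |F|.to (ℓ a) Fin.≟ v)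
      fibre = largeFibre (|F|.to ∘ ℓ) K′ qK′<N
      λ′ : 𝔽.Carrier
      λ′ = |F|.from (proj₁ fibre)
      d : Vect E N
      d a = c′ a 𝔼.+ 𝔼.- ι λ′ 𝔼.* c a
      d∈C : C d
      d∈C = IsLinear.closed-+ linear c′∈C (IsLinear.closed-• linear (𝔼.- ι λ′) c∈C)
      d≡0-in-fibre : ∀ a → |F|.to (ℓ a) ≡ proj₁ fibre → d a ≡ 𝔼.0#
      d≡0-in-fibre a ℓₐ∈fibre = begin
        c′ a 𝔼.+ 𝔼.- ι λ′ 𝔼.* c a          ≡⟨ cong (𝔼._+ 𝔼.- ι λ′ 𝔼.* c a) (proj₂ (factor a)) ⟩
        ι (ℓ a) 𝔼.* c a 𝔼.+ 𝔼.- ι λ′ 𝔼.* c a ≡⟨ cong (λ x → ι x 𝔼.* c a 𝔼.+ 𝔼.- ι λ′ 𝔼.* c a) ℓₐ≡λ′ ⟩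
        ι λ′ 𝔼.* c a 𝔼.+ 𝔼.- ι λ′ 𝔼.* c a    ≡⟨ 𝔼.distribʳ (c a) _ _ ⟨
        (ι λ′ 𝔼.- ι λ′) 𝔼.* c a             ≡⟨ cong (𝔼._* c a) (𝔼.-‿inverseʳ (ι λ′)) ⟩
        𝔼.0# 𝔼.* c a                        ≡⟨ 𝔼.zeroˡ (c a) ⟩
        𝔼.0#                               ∎
        where
        open ≡-Reasoning
        ℓₐ≡λ′ : ℓ a ≡ λ′
        ℓₐ≡λ′ = trans (sym (|F|.strictlyInverseʳ (ℓ a))) (cong |F|.from ℓₐ∈fibre)
      d≡0 : ∀ a → d a ≡ 𝔼.0#
      d≡0 with 𝔼.nonZero? d
      ... | no  ¬d≢0 = 𝔼.¬NonZero⇒≡0 ¬d≢0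
      ... | yes d≢0  = contradiction (fewZeros d d∈C d≢0) (ℕ.<⇒≱ (begin-strict
        K′                                              <⟨ proj₂ fibre ⟩
        count (λ a → |F|.to (ℓ a) Fin.≟ proj₁ fibre)     ≤⟨ count-mono _ _ (λ {a} → d≡0-in-fibre a) ⟩
        𝔼.zeros d                                       ∎))
        where open ℕ.≤-Reasoning
      c′≡λ′c : ∀ a → c′ a ≡ ι λ′ 𝔼.* c a
      c′≡λ′c a = 𝔼.x∙y⁻¹≈ε⇒x≈y _ _ (trans (cong (c′ a 𝔼.+_) (𝔼.-‿distribˡ-* (ι λ′) (c a))) (d≡0 a))
      w′≡λ′w : ∀ i → w′ i ≡ λ′ 𝔽.* w i
      w′≡λ′w i = begin
        w′ i                                   ≡⟨ w′≗ i ⟩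
        π (c′ a) b                             ≡⟨ cong (λ x → π x b) (c′≡λ′c a) ⟩
        π (ι λ′ 𝔼.* c a) b                      ≡⟨ π-• λ′ (c a) b ⟩
        λ′ 𝔽.* π (c a) b                        ≡⟨ cong (λ′ 𝔽.*_) (w≗ i) ⟨
        λ′ 𝔽.* w i                              ∎
        where
        open ≡-Reasoning
        a : Fin N
        a = proj₁ (remQuot {N} n i)
        b : Fin n
        b = proj₂ (remQuot {N} n i)

  module Dimension {K k} (dim : HasDimension E C K) (eb : Fin k → 𝔼.Carrier)
                   (eb-independent : Independent eb) (eb-spans : ∀ x → InSpan eb x) where
    cb : Fin K → Vect E N
    cb = proj₁ dim

    generator : Fin (K ℕ.* k) → Vect F (N ℕ.* n)
    generator ℓ = expand (λ a → eb (proj₂ (remQuot {K} k ℓ)) 𝔼.* cb (proj₁ (remQuot {K} k ℓ)) a)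

    coefficients : (Fin (K ℕ.* k) → 𝔽.Carrier) → Fin K → 𝔼.Carrier
    coefficients u s = combination eb (λ t → u (combine s t))

    codeword : (Fin (K ℕ.* k) → 𝔽.Carrier) → Vect E N
    codeword u = linComb E (coefficients u) cb

    linComb-generator : ∀ u → linComb F u generator ≗ expand (codeword u)
    linComb-generator u i = begin
      sumF F (λ ℓ → u ℓ 𝔽.* generator ℓ i)
        ≡⟨ 𝔽.sumF-combine K (λ ℓ → u ℓ 𝔽.* generator ℓ i) ⟩
      sumF F (λ (s : Fin K) → sumF F (λ (t : Fin k) → u (combine s t) 𝔽.* generator (combine s t) i))
        ≡⟨ 𝔽.sumF-cong (λ s → 𝔽.sumF-cong (λ t → trans (cong (u (combine s t) 𝔽.*_) (generator-entry s t))
                                                          (sym (π-• (u (combine s t)) _ b)))) ⟩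
      sumF F (λ (s : Fin K) → sumF F (λ (t : Fin k) → π (term s t) b))
        ≡⟨ 𝔽.sumF-cong (λ s → π-sum (term s) b) ⟨
      sumF F (λ (s : Fin K) → π (sumF E (term s)) b)
        ≡⟨ π-sum (λ s → sumF E (term s)) b ⟨
      π (sumF E (λ s → sumF E (term s))) b
        ≡⟨ cong (λ x → π x b) (𝔼.sumF-cong inner) ⟩
      π (sumF E (λ s → coefficients u s 𝔼.* cb s a)) b
        ∎
      where
      open ≡-Reasoning
      a : Fin N
      a = proj₁ (remQuot {N} n i)
      b : Fin n
      b = proj₂ (remQuot {N} n i)
      term : Fin K → Fin k → 𝔼.Carrier
      term s t = ι (u (combine s t)) 𝔼.* (eb t 𝔼.* cb s a)
      generator-entry : ∀ s t → generator (combine s t) i ≡ π (eb t 𝔼.* cb s a) b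
      generator-entry s t = cong (λ (s , t) → π (eb t 𝔼.* cb s a) b) (Fin.remQuot-combine {K} {k} s t)
      inner : ∀ s → sumF E (term s) ≡ coefficients u s 𝔼.* cb s a
      inner s = trans (𝔼.sumF-cong {k} (λ t → sym (𝔼.*-assoc (ι (u (combine s t))) (eb t) (cb s a))))
                      (sym (𝔼.*-distribʳ-sumF (cb s a) (λ t → ι (u (combine s t)) 𝔼.* eb t)))

    concat-dimension : HasDimension F W (K ℕ.* k)
    concat-dimension = generator , generator∈W , generators-span , generators-independent
      where
      open Σ (proj₂ dim) renaming (proj₁ to cb∈C; proj₂ to C-spanned-independent)
      generator∈W : ∀ u → W (linComb F u generator)
      generator∈W u = codeword u , cb∈C (coefficients u) , linComb-generator u

      generators-span : ∀ w → W w → ∃ λ u → ∀ i → w i ≡ linComb F u generator i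
      generators-span w (c , c∈C , w≗) = u , λ i →
        trans (w≗ i) (trans (cong (λ x → π x _) (c≡codeword _)) (sym (linComb-generator u i)))
        where
        y : Fin K → 𝔼.Carrier
        y = proj₁ (proj₁ C-spanned-independent c c∈C)
        z : Fin K → Fin k → 𝔽.Carrier
        z s = proj₁ (eb-spans (y s))
        u : Fin (K ℕ.* k) → 𝔽.Carrier
        u ℓ = z (proj₁ (remQuot {K} k ℓ)) (proj₂ (remQuot {K} k ℓ))
        y≡coefficients : ∀ s → y s ≡ coefficients u s
        y≡coefficients s = trans (proj₂ (eb-spans (y s))) (combination-cong eb λ t →
          cong (λ (s , t) → z s t) (sym (Fin.remQuot-combine {K} {k} s t)))
        c≡codeword : ∀ a → c a ≡ codeword u a
        c≡codeword a = trans (proj₂ (proj₁ C-spanned-independent c c∈C) a) (𝔼.linComb-cong cb y≡coefficients a)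

      generators-independent : ∀ u → (∀ i → linComb F u generator i ≡ 𝔽.0#) → ∀ ℓ → u ℓ ≡ 𝔽.0#
      generators-independent u Σ≡0 ℓ =
        trans (cong u (sym (Fin.combine-remQuot {K} k ℓ)))
              (u≡0 (proj₁ (remQuot {K} k ℓ)) (proj₂ (remQuot {K} k ℓ)))
        where
        codeword≡0 : ∀ a → codeword u a ≡ 𝔼.0#
        codeword≡0 a = π≡0⇒≡0 _ λ b →
          trans (sym (expand-combine (codeword u) a b)) (trans (sym (linComb-generator u (combine a b))) (Σ≡0 _))
        u≡0 : ∀ s t → u (combine s t) ≡ 𝔽.0#
        u≡0 s = eb-independent _ (proj₂ C-spanned-independent (coefficients u) codeword≡0 s)

module Theorems {F E : Field} {ι : Field.Carrier F → Field.Carrier E} (hom : IsFieldHom F E ι)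
  {q k} (|F|≡q : HasOrder F q) (|E|≡q^k : HasOrder E (q ℕ.^ k))
  {n d} {I : Code F n} (I-code : IsCode F n k d I) (I-minimal : IsMinimal F I) where
  private
    module 𝔽 = FieldProperties F
    module 𝔼 = FieldProperties E
    module |E| = Inverse |E|≡q^k
  open Combinations hom
  open StrongBlockingSets F using (minimal⇒strongBlockingSet)

  eb : Fin k → 𝔼.Carrier
  eb = proj₁ (Extension.basis hom |F|≡q |E|≡q^k)

  eb-independent : Independent eb
  eb-independent = proj₁ (proj₂ (Extension.basis hom |F|≡q |E|≡q^k))

  eb-spans : ∀ x → InSpan eb x
  eb-spans = proj₂ (proj₂ (Extension.basis hom |F|≡q |E|≡q^k))

  concatenation-theorem : ∀ {N K′ D} {C : Code E N} → IsMDS E N (suc K′) D C → q ℕ.* K′ ℕ.< N →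
    (π : 𝔼.Carrier → Vect F n) → IsLinearInjectionOnto F E ι π I →
      IsLinear F (concat F E ι π C)
    × HasDimension F (concat F E ι π C) (suc K′ ℕ.* k)
    × MinDistAtLeast F (concat F E ι π C) (D ℕ.* d)
    × IsMinimal F (concat F E ι π C)
  concatenation-theorem {D = D} mds qK′<N π π-injection =
      concat-linear linear
    , concat-dimension
    , concat-minDist D d π∈I (proj₁ minDist) (proj₁ (IsCode.minDist I-code))
    , concat-minimal π∈I I-minimal |F|≡q linear (𝔼.MDS⇒zeros≤K′ mds) qK′<N
    where
    open IsLinearInjectionOnto π-injection
    open IsCode (IsMDS.code mds)
    open Concatenation hom π π-+ π-• π-inj _
    open Dimension dim eb eb-independent eb-spans
    π∈I : ∀ x → I (π x)
    π∈I x = Equivalence.from (π-image (π x)) (x , λ _ → refl)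

  module CoordinateEmbedding where
    bI : Fin k → Vect F n
    bI = proj₁ (IsCode.dim I-code)
    bI∈I : ∀ u → I (linComb F u bI)
    bI∈I = proj₁ (proj₂ (IsCode.dim I-code))
    open Independence F (proj₂ (proj₂ (proj₂ (IsCode.dim I-code))))

    coordinates : 𝔼.Carrier → Fin k → 𝔽.Carrier
    coordinates x = proj₁ (eb-spans x)

    coordinates-unique : ∀ x u → x ≡ combination eb u → coordinates x ≗ u
    coordinates-unique x u x≡ =
      combination-injective eb eb-independent _ _ (trans (sym (proj₂ (eb-spans x))) x≡)

    π : 𝔼.Carrier → Vect F n
    π x = linComb F (coordinates x) bI

    π∈I : ∀ x → I (π x)
    π∈I x = bI∈I (coordinates x)

    π-+ : ∀ x y j → π (x 𝔼.+ y) j ≡ π x j 𝔽.+ π y j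
    π-+ x y j = trans (𝔽.linComb-cong bI (coordinates-unique (x 𝔼.+ y) _ x+y≡) j)
                      (𝔽.linComb-+ bI (coordinates x) (coordinates y) j)
      where
      x+y≡ : x 𝔼.+ y ≡ combination eb (λ t → coordinates x t 𝔽.+ coordinates y t)
      x+y≡ = trans (cong₂ 𝔼._+_ (proj₂ (eb-spans x)) (proj₂ (eb-spans y)))
                   (sym (combination-+ eb (coordinates x) (coordinates y)))

    π-• : ∀ a x j → π (ι a 𝔼.* x) j ≡ a 𝔽.* π x j
    π-• a x j = trans (𝔽.linComb-cong bI (coordinates-unique (ι a 𝔼.* x) _ ax≡) j)
                      (𝔽.linComb-• bI a (coordinates x) j)
      where
      ax≡ : ι a 𝔼.* x ≡ combination eb (λ t → a 𝔽.* coordinates x t)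
      ax≡ = trans (cong (ι a 𝔼.*_) (proj₂ (eb-spans x))) (sym (combination-• eb a (coordinates x)))

    π-injective : ∀ x y → (∀ j → π x j ≡ π y j) → x ≡ y
    π-injective x y πx≡πy = begin
      x                                ≡⟨ proj₂ (eb-spans x) ⟩
      combination eb (coordinates x)   ≡⟨ combination-cong eb (linComb-injective πx≡πy) ⟩
      combination eb (coordinates y)   ≡⟨ proj₂ (eb-spans y) ⟨
      y                                ∎
      where open ≡-Reasoning

  strongBlockingSet-exists : ∀ K′ r → K′ ℕ.+ r ℕ.≤ q ℕ.^ k → q ℕ.* K′ ℕ.≤ K′ ℕ.+ r → 0 ℕ.< k →
                             Σ (Fin (suc (K′ ℕ.+ r) ℕ.* n) → Vect F (suc K′ ℕ.* k)) (IsStrongBlockingSet F)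
  strongBlockingSet-exists K′ r K′+r≤q^k qK′≤K′+r 0<k =
    minimal⇒strongBlockingSet concat-dimension minimal (ℕ.≤-trans 0<k (ℕ.m≤m+n k (K′ ℕ.* k)))
    where
    α : Fin (K′ ℕ.+ r) → 𝔼.Carrier
    α j = |E|.from (Fin.inject≤ j K′+r≤q^k)
    α-injective : Injective _≡_ _≡_ α
    α-injective = Fin.inject≤-injective _ _ _ _ ∘ Injection.injective (↔⇒↣ (↔-sym |E|≡q^k))
    open ReedSolomon E {K′} {r} α α-injective
    open CoordinateEmbedding
    open Concatenation hom π π-+ π-• π-injective RS
    open Dimension RS-dimension eb eb-independent eb-spans
    minimal : IsMinimal F W
    minimal = concat-minimal π∈I I-minimal |F|≡q RS-linear zeros≤K′ (s≤s qK′≤K′+r)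

q*K′≡K′+[q∸1]*K′ : ∀ {q} → 1 ℕ.≤ q → ∀ K′ → q ℕ.* K′ ≡ K′ ℕ.+ (q ℕ.∸ 1) ℕ.* K′
q*K′≡K′+[q∸1]*K′ {suc q′} _ K′ = refl

q*[1+K′]∸[q∸1]≡1+K′+[q∸1]*K′ : ∀ {q} → 1 ℕ.≤ q → ∀ K′ →
                              q ℕ.* suc K′ ℕ.∸ (q ℕ.∸ 1) ≡ suc (K′ ℕ.+ (q ℕ.∸ 1) ℕ.* K′)
q*[1+K′]∸[q∸1]≡1+K′+[q∸1]*K′ {suc q′} _ K′ =
  trans (cong (ℕ._∸ q′) (expand q′ K′)) (ℕ.m+n∸m≡n q′ _)
  where
  expand : ∀ q′ K′ → suc q′ ℕ.* suc K′ ≡ q′ ℕ.+ suc (K′ ℕ.+ q′ ℕ.* K′)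
  expand = solve-∀

n*q*[1+K′]∸q*n+n≡[1+K′+[q∸1]*K′]*n : ∀ {q} → 1 ℕ.≤ q → ∀ K′ n →
  n ℕ.* q ℕ.* suc K′ ℕ.∸ q ℕ.* n ℕ.+ n ≡ suc (K′ ℕ.+ (q ℕ.∸ 1) ℕ.* K′) ℕ.* n
n*q*[1+K′]∸q*n+n≡[1+K′+[q∸1]*K′]*n {suc q′} _ K′ n = begin
  n ℕ.* q ℕ.* suc K′ ℕ.∸ q ℕ.* n ℕ.+ n                  ≡⟨ cong (λ x → x ℕ.∸ q ℕ.* n ℕ.+ n) (split q′ K′ n) ⟩
  q ℕ.* n ℕ.+ n ℕ.* q ℕ.* K′ ℕ.∸ q ℕ.* n ℕ.+ n          ≡⟨ cong (ℕ._+ n) (ℕ.m+n∸m≡n (q ℕ.* n) _) ⟩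
  n ℕ.* q ℕ.* K′ ℕ.+ n                                ≡⟨ regroup q′ K′ n ⟩
  suc (K′ ℕ.+ q′ ℕ.* K′) ℕ.* n                        ∎
  where
  open ≡-Reasoning
  q : ℕ
  q = suc q′
  split : ∀ q′ K′ n → n ℕ.* suc q′ ℕ.* suc K′ ≡ suc q′ ℕ.* n ℕ.+ n ℕ.* suc q′ ℕ.* K′
  split = solve-∀
  regroup : ∀ q′ K′ n → n ℕ.* suc q′ ℕ.* K′ ℕ.+ n ≡ suc (K′ ℕ.+ q′ ℕ.* K′) ℕ.* n
  regroup = solve-∀

mainTheorem2 :
    (q k K n d : ℕ.ℕ) (F E : Field) (ι : Field.Carrier F → Field.Carrier E) →
    IsPrimePower q → HasOrder F q → HasOrder E (q ℕ.^ k) → IsFieldHom F E ι →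
    1 ℕ.< k → 1 ℕ.≤ K → K ℕ.≤ q ℕ.^ (k ℕ.∸ 1) ℕ.+ 1 →
    (I : Code F n) → IsCode F n k d I → IsMinimal F I →
    ((C : Code E (q ℕ.* K ℕ.∸ (q ℕ.∸ 1))) →
       IsMDS E (q ℕ.* K ℕ.∸ (q ℕ.∸ 1)) K ((q ℕ.∸ 1) ℕ.* (K ℕ.∸ 1) ℕ.+ 1) C →
       (π : Field.Carrier E → Vect F n) → IsLinearInjectionOnto F E ι π I →
         IsLinear F (concat F E ι π C)
       × HasDimension F (concat F E ι π C) (K ℕ.* k)
       × MinDistAtLeast F (concat F E ι π C) (((q ℕ.∸ 1) ℕ.* (K ℕ.∸ 1) ℕ.+ 1) ℕ.* d)
       × IsMinimal F (concat F E ι π C))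
    × (Σ (Fin (n ℕ.* q ℕ.* K ℕ.∸ q ℕ.* n ℕ.+ n) → Vect F (K ℕ.* k)) λ p → IsStrongBlockingSet F p)
-- Only 2 ≤ q (forced by HasOrder F q) and k ≥ 1 are used.
mainTheorem2 q (suc k₁) (suc K′) n d F E ι _ |F|≡q |E|≡q^k hom (s≤s _) (s≤s _) K≤q^k₁+1 I I-code I-minimal =
    (λ C mds → concatenation-theorem mds (ℕ.≤-reflexive 1+qK′≡N))
  , subst (λ S → Σ (Fin S → Vect F (suc K′ ℕ.* suc k₁)) (IsStrongBlockingSet F))
          (sym (n*q*[1+K′]∸q*n+n≡[1+K′+[q∸1]*K′]*n 1≤q K′ n))
          (strongBlockingSet-exists K′ r K′+r≤q^k (ℕ.≤-reflexive qK′≡K′+r) (s≤s z≤n))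
  where
  open Theorems hom |F|≡q |E|≡q^k I-code I-minimal
  1≤q : 1 ℕ.≤ q
  1≤q = ℕ.<⇒≤ (2≤order F |F|≡q)
  r : ℕ
  r = (q ℕ.∸ 1) ℕ.* K′
  qK′≡K′+r : q ℕ.* K′ ≡ K′ ℕ.+ r
  qK′≡K′+r = q*K′≡K′+[q∸1]*K′ 1≤q K′
  1+qK′≡N : suc (q ℕ.* K′) ≡ q ℕ.* suc K′ ℕ.∸ (q ℕ.∸ 1)
  1+qK′≡N = trans (cong suc qK′≡K′+r) (sym (q*[1+K′]∸[q∸1]≡1+K′+[q∸1]*K′ 1≤q K′))
  K′+r≤q^k : K′ ℕ.+ r ℕ.≤ q ℕ.^ suc k₁
  K′+r≤q^k = subst (ℕ._≤ q ℕ.^ suc k₁) qK′≡K′+r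
                   (ℕ.*-monoʳ-≤ q (ℕ.s≤s⁻¹ (subst (suc K′ ℕ.≤_) (ℕ.+-comm _ 1) K≤q^k₁+1)))
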